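{- Let $D$ be an $m$-regular thickened ribbon, represented by a box-dotted composition. Then $$s_D=(-1)^{\ell(D)}\sum_{(S;k)\succeq (D;0)}(-1)^{\ell(S)}\,h_{m-1}^{k}\,h_{\lambda(S)},$$ where the sum runs over all pairs $(S;k)$ with $(D;0)\preceq(S;k)$.
   Context: Fix $m\ge 2$. A box-dotted composition is a finite sequence of positive integers in which some consecutive pairs of integers are separated by a box-dot $\boxdot$, each box-dot having both neighbouring integers at least $m$. Its diagram is the skew diagram whose rows, from bottom to top, have the listed numbers of boxes, where for two consecutive rows the leftmost $j$ boxes of the upper row lie directly above the rightmost $j$ boxes of the lower row, with $j=m$ if the two integers are separated by a box-dot and $j=1$ otherwise; these diagrams are the $m$-regular thickened ribbons (connected skew diagrams with no $3\times 3$ and no $3\times 2$ blocks, whose $2\times 2$ sub-squares form $2\times m$ blocks), and $D$ is identified with its box-dotted composition. $\alpha(D)$ is the composition obtained by deleting all box-dots, $\ell(D)$ its number of parts, and $\lambda(D)$ the partition obtained by sorting the parts of $\alpha(D)$ in weakly decreasing order. $h_\lambda=h_{\lambda_1}h_{\lambda_2}\cdots$ are complete homogeneous symmetric functions and $s_D$ is the skew Schur function of $D$. A pair $(D;k)$ consists of a box-dotted composition $D$ and an integer $k\ge0$; its size is $|\alpha(D)|+k(m-1)$. For pairs of the same size, with $\alpha(S)=\alpha_1\cdots\alpha_\ell$, $(T;p)$ covers $(S;k)$ if either (1) $p=k$ and for some $i$ there is no box-dot between $\alpha_i$ and $\alpha_{i+1}$ in $S$ and $T$ is obtained from $S$ by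 replacing $\alpha_i\alpha_{i+1}$ by $\alpha_i+\alpha_{i+1}$; or (2) $p=k+1$ and for some $i$ there is a box-dot between $\alpha_i,\alpha_{i+1}$ and $T$ is obtained from $S$ by replacing $\alpha_i\boxdot\alpha_{i+1}$ by $\alpha_i+\alpha_{i+1}-m+1$. $\preceq$ is the reflexive-transitive closure of the covering relation. -}

module Defs where

open import Data.Bool using (Bool; true; false; if_then_else_; _∧_)
open import Data.Nat as ℕ using (ℕ; zero; suc; _+_; _∸_; _≤_; _<ᵇ_; _≡ᵇ_; _≤ᵇ_)
open import Data.Nat.Properties using (≤-decTotalOrder)
open import Data.Integer as ℤ using (ℤ; -_)
open import Data.Fin using (Fin; toℕ)
open import Data.Vec using (Vec; []; _∷_; toList)
open import Data.List using (List; []; _∷_; [_]; map; concat; concatMap; foldr; length;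
  zip; allFin; upTo; reverse)
open import Data.List.Relation.Unary.All using (All)
open import Data.List.Membership.Propositional using (_∈_)
open import Data.Product using (_×_; _,_; proj₁; proj₂; ∃-syntax)
open import Relation.Nullary using (¬_)
open import Relation.Binary.PropositionalEquality using (_≡_)
open import Relation.Binary.Construct.Closure.ReflexiveTransitive using (Star)
open import Data.Sum using (_⊎_)
import Data.List.Sort

-- Box-dotted compositions
--   ⟨ a ⟩            : the one-part composition a
--   a ∷⟨ b ⟩ D       : a followed by D; b = true means a box-dot
--                      separates a from the first part of D

data BDC : Set where
  ⟨_⟩    : ℕ → BDC
  _∷⟨_⟩_ : ℕ → Bool → BDC → BDC

infixr 5 _∷⟨_⟩_

head : BDC → ℕ
head ⟨ a ⟩        = a
head (a ∷⟨ _ ⟩ _) = a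

α : BDC → List ℕ
α ⟨ a ⟩        = [ a ]
α (a ∷⟨ _ ⟩ D) = a ∷ α D

ℓ : BDC → ℕ
ℓ D = length (α D)

λ[_] : BDC → List ℕ
λ[ D ] = reverse (sort (α D))
  where open Data.List.Sort ≤-decTotalOrder using (sort)

data Valid (m : ℕ) : BDC → Set where
  one  : ∀ {a} → 1 ≤ a → Valid m ⟨ a ⟩
  cons : ∀ {a D} → 1 ≤ a → Valid m D → Valid m (a ∷⟨ false ⟩ D)
  dot  : ∀ {a D} → 1 ≤ a → m ≤ a → m ≤ head D → Valid m D → Valid m (a ∷⟨ true ⟩ D)

-- Cells are (row , column); rows are numbered 0,1,2,… from the bottom,
-- columns 0,1,2,… from the left.  Consecutive rows overlap in j columns,
-- j = m across a box-dot and j = 1 otherwise.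

ovl : ℕ → Bool → ℕ
ovl m true  = m
ovl m false = 1

-- rows (start column , length), bottom to top, first row starting at s
rowsFrom : ℕ → ℕ → BDC → List (ℕ × ℕ)
rowsFrom m s ⟨ a ⟩        = [ (s , a) ]
rowsFrom m s (a ∷⟨ b ⟩ D) = (s , a) ∷ rowsFrom m (s + a ∸ ovl m b) D

cellsOfRows : ℕ → List (ℕ × ℕ) → List (ℕ × ℕ)
cellsOfRows r []             = []
cellsOfRows r ((s , a) ∷ rs) = map (λ t → (r , s + t)) (upTo a) Data.List.++ cellsOfRows (suc r) rs

cells : ℕ → BDC → List (ℕ × ℕ)
cells m D = cellsOfRows 0 (rowsFrom m 0 D)

No3×2 : ℕ → BDC → Set
No3×2 m D = ¬ (∃[ r ] ∃[ c ] All (_∈ cells m D)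
  ((r , c) ∷ (r , suc c) ∷ (suc r , c) ∷ (suc r , suc c)
   ∷ (suc (suc r) , c) ∷ (suc (suc r) , suc c) ∷ []))

No3×3 : ℕ → BDC → Set
No3×3 m D = ¬ (∃[ r ] ∃[ c ] All (_∈ cells m D)
  (concatMap (λ i → map (λ j → (r + i , c + j)) (upTo 3)) (upTo 3)))

-- D (a box-dotted composition) is an m-regular thickened ribbon.
-- (Connectedness, being a skew diagram, and 2×2 squares forming 2×m blocks
--  are automatic for diagrams of valid box-dotted compositions once
--  3×2 blocks are excluded.)
ThickenedRibbon : ℕ → BDC → Set
ThickenedRibbon m D = Valid m D × No3×3 m D × No3×2 m D

mergeVal : ℕ → Bool → ℕ → ℕ → ℕ
mergeVal m false a c = a + c
mergeVal m true  a c = a + c + 1 ∸ m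

data Merge (m : ℕ) (b : Bool) : BDC → BDC → Set where
  here₁ : ∀ {a c} → Merge m b (a ∷⟨ b ⟩ ⟨ c ⟩) ⟨ mergeVal m b a c ⟩
  here₂ : ∀ {a c s D} → Merge m b (a ∷⟨ b ⟩ (c ∷⟨ s ⟩ D)) (mergeVal m b a c ∷⟨ s ⟩ D)
  there : ∀ {a s S T} → Merge m b S T → Merge m b (a ∷⟨ s ⟩ S) (a ∷⟨ s ⟩ T)

Pair : Set
Pair = BDC × ℕ

-- (T ; p) covers (S ; k)
data Covers (m : ℕ) : Pair → Pair → Set where
  plain  : ∀ {S T k} → Merge m false S T → Covers m (S , k) (T , k)
  dotted : ∀ {S T k} → Merge m true  S T → Covers m (S , k) (T , suc k)

_⪯[_]_ : Pair → ℕ → Pair → Set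
P ⪯[ m ] Q = Star (Covers m) P Q

-- Symmetric functions, evaluated in n variables x : Fin n → ℤ

sumℤ : List ℤ → ℤ
sumℤ = foldr ℤ._+_ (ℤ.+ 0)

prodℤ : List ℤ → ℤ
prodℤ = foldr ℤ._*_ (ℤ.+ 1)

words : (n k : ℕ) → List (Vec (Fin n) k)
words n zero    = [ [] ]
words n (suc k) = concatMap (λ i → map (i ∷_) (words n k)) (allFin n)

weaklyIncr : ∀ {n k} → Vec (Fin n) k → Bool
weaklyIncr [] = true
weaklyIncr (i ∷ []) = true
weaklyIncr (i ∷ j ∷ v) = (toℕ i ≤ᵇ toℕ j) ∧ weaklyIncr (j ∷ v)

monomial : ∀ {n} → (Fin n → ℤ) → List (Fin n) → ℤ
monomial x is = prodℤ (map x is)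

h : (n : ℕ) → (Fin n → ℤ) → ℕ → ℤ
h n x k = sumℤ (map (λ v → if weaklyIncr v then monomial x (toList v) else ℤ.+ 0)
                    (words n k))

hPart : (n : ℕ) → (Fin n → ℤ) → List ℕ → ℤ
hPart n x λs = prodℤ (map (h n x) λs)

-- semistandard condition for a pair of filled cells (English convention:
-- rows weakly increase to the right, columns strictly increase downwards,
-- i.e. a cell in a higher row has a strictly smaller entry)
compatible : ∀ {n} → (ℕ × ℕ) × Fin n → (ℕ × ℕ) × Fin n → Bool
compatible ((r , c) , v) ((r' , c') , v') =
  (if (r ≡ᵇ r') ∧ (c <ᵇ c') then toℕ v ≤ᵇ toℕ v' else true) ∧
  (if (c ≡ᵇ c') ∧ (r <ᵇ r') then toℕ v' <ᵇ toℕ v else true)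

allB : {A : Set} → (A → Bool) → List A → Bool
allB p = foldr (λ a b → p a ∧ b) true

semistandard : ∀ {n} → List ((ℕ × ℕ) × Fin n) → Bool
semistandard T = allB (λ p → allB (compatible p) T) T

skewSchur : (m n : ℕ) → (Fin n → ℤ) → BDC → ℤ
skewSchur m n x D =
  sumℤ (map (λ v → if semistandard (zip (cells m D) (toList v))
                   then monomial x (toList v) else ℤ.+ 0)
            (words n (length (cells m D))))

sign : ℕ → ℤ
sign k = (- ℤ.+ 1) ℤ.^ k

term : (m n : ℕ) → (Fin n → ℤ) → Pair → ℤ
term m n x (S , k) = sign (ℓ S) ℤ.* (h n x (m ∸ 1) ℤ.^ k ℤ.* hPart n x λ[ S ])

-- The skew Schur function of D is computed row by row from the bottom: a
-- filling is semistandard iff every row weakly increases and no two adjacent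
-- rows clash, i.e. have entries violating column strictness in a shared column.
-- For D = a ∷⟨ δ ⟩ B, subtracting s_D from h_a s_B leaves the fillings whose
-- two bottom rows clash.  Comparing these rows entry by entry, an induction on
-- the overlap o shows that they contribute h_{o-1} s_D′, where D′ merges the two
-- bottom parts; the induction needs the overlaps of each row with its two
-- neighbours to share at most one column, which is where the absence of 3 × 2
-- blocks enters.  So s_D = h_a s_B - h_{o-1} s_D′, where h_{o-1} is 1 or h_{m-1}.
-- The signed sum over the pairs above (D ; 0) obeys the same recurrence, since
-- such a pair either never merges the first separator, or can be reached by
-- merging it first; induction on D then proves the expansion.

module Submission where

open import Defs

open import Algebra.Bundles using (CommutativeMonoid)
import Algebra.Properties.CommutativeSemigroup as CommSemigroupProperties
open import Data.Bool using (Bool; true; false; if_then_else_; _∧_; _∨_; not; T)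
import Data.Bool.Properties
open import Data.Empty using (⊥-elim)
open import Data.Fin using (Fin; toℕ)
open import Data.Integer as ℤ using (ℤ; -_; _+_; _*_; _-_; 0ℤ; 1ℤ)
import Data.Integer.Properties as ℤ
open import Data.Integer.Tactic.RingSolver using (solve-∀)
open import Data.List using (List; []; _∷_; [_]; map; length; allFin; concatMap; _++_; drop; take; zip; upTo; applyUpTo)
import Data.List.Properties as List
open import Data.List.Membership.Propositional using (_∈_)
open import Data.List.Membership.Propositional.Properties using (∈-map⁺; ∈-map⁻; ∈-++⁺ˡ; ∈-++⁺ʳ; ∈-++⁻)
open import Data.List.Membership.Propositional.Properties.WithK using (unique∧set⇒bag)
open import Data.List.Relation.Binary.BagAndSetEquality using (∼bag⇒↭)
open import Data.List.Relation.Binary.Permutation.Propositional using (_↭_; ↭⇒↭ₛ; ↭-trans)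
import Data.List.Relation.Binary.Permutation.Propositional.Properties as ↭
open import Data.List.Relation.Binary.Permutation.Setoid.Properties using (foldr-commMonoid)
open import Data.List.Relation.Unary.All as All using (All; []; _∷_)
import Data.List.Relation.Unary.All.Properties as Allₚ
open import Data.List.Relation.Unary.AllPairs using ([]; _∷_)
open import Data.List.Relation.Unary.Any using (here; there)
open import Data.List.Relation.Unary.Unique.Propositional using (Unique)
import Data.List.Relation.Unary.Unique.Propositional.Properties as Uniqueₚ
open import Data.Nat as ℕ using (ℕ; zero; suc; _∸_; _≤_; _<_; z≤n; s≤s; _≤ᵇ_; _<ᵇ_; _≡ᵇ_)
import Data.Nat.Properties as ℕ
open import Data.Nat.Tactic.RingSolver using () renaming (solve-∀ to ℕ-solve-∀)
open import Data.List.Sort ℕ.≤-decTotalOrder using (sort; sort-↭)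
open import Data.Product as Product using (_×_; _,_; proj₁; proj₂; uncurry; ∃-syntax)
open import Data.Product.Function.NonDependent.Propositional using (_×-⇔_)
open import Data.Sum using (_⊎_; inj₁; inj₂)
open import Data.Unit using (⊤)
open import Data.Vec as Vec using (Vec; toList)
open import Function using (_∘_; const; _⇔_; Equivalence; mk⇔)
import Function.Properties.Equivalence as ⇔
open import Relation.Binary.Construct.Closure.ReflexiveTransitive using (ε; _◅_)
open import Relation.Binary.PropositionalEquality
  using (_≡_; _≢_; refl; sym; trans; cong; cong₂; subst; module ≡-Reasoning)
open import Relation.Nullary using (¬_; yes; no)

private
  variable
    A B : Set

  module +-Comm = CommSemigroupProperties ℤ.+-commutativeSemigroup
  module *-Comm = CommSemigroupProperties ℤ.*-commutativeSemigroup

lastN : ℕ → List A → List A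
lastN k u = drop (length u ∸ k) u

lastN-∷ : ∀ k (i : A) u → k ≤ length u → lastN k (i ∷ u) ≡ lastN k u
lastN-∷ k i u k≤u rewrite ℕ.+-∸-assoc 1 k≤u = refl

lastN-++ : ∀ k (v u : List A) → k ≤ length u → lastN k (v ++ u) ≡ lastN k u
lastN-++ k []      u k≤u = refl
lastN-++ k (i ∷ v) u k≤u =
  trans (lastN-∷ k i (v ++ u) (subst (k ≤_) (sym (List.length-++ v)) (ℕ.≤-trans k≤u (ℕ.m≤n+m _ _))))
        (lastN-++ k v u k≤u)

lastN-++-length : ∀ {k} (v u : List A) → length u ≡ k → lastN k (v ++ u) ≡ u
lastN-++-length v u refl rewrite lastN-++ (length u) v u ℕ.≤-refl | ℕ.n∸n≡0 (length u) = refl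

zip-++ : ∀ {C : Set} (X : List A) Y (u : List C) v → length X ≡ length u → zip (X ++ Y) (u ++ v) ≡ zip X u ++ zip Y v
zip-++ []      Y []      v _     = refl
zip-++ (a ∷ X) Y (c ∷ u) v |X|≡ = cong ((a , c) ∷_) (zip-++ X Y u v (ℕ.suc-injective |X|≡))

drop-length-++ : ∀ (u v : List A) → drop (length u) (u ++ v) ≡ v
drop-length-++ []      v = refl
drop-length-++ (a ∷ u) v = drop-length-++ u v

take-length-++ : ∀ (u v : List A) → take (length u) (u ++ v) ≡ u
take-length-++ []      v = refl
take-length-++ (a ∷ u) v = cong (a ∷_) (take-length-++ u v)

T-ext : ∀ {a b} → T a ⇔ T b → a ≡ b
T-ext {false} {false} _   = refl
T-ext {false} {true}  a⇔b = ⊥-elim (Equivalence.from a⇔b _)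
T-ext {true}  {false} a⇔b = ⊥-elim (Equivalence.to a⇔b _)
T-ext {true}  {true}  _   = refl

¬T⇒≡false : ∀ {b} → ¬ T b → b ≡ false
¬T⇒≡false {false} _  = refl
¬T⇒≡false {true}  ¬t = ⊥-elim (¬t _)

T⇒≡true : ∀ {b} → T b → b ≡ true
T⇒≡true = Equivalence.to Data.Bool.Properties.T-≡

≤ᵇ-true : ∀ {m n} → m ≤ n → (m ≤ᵇ n) ≡ true
≤ᵇ-true = T⇒≡true ∘ ℕ.≤⇒≤ᵇ

≡ᵇ-refl : ∀ k → (k ≡ᵇ k) ≡ true
≡ᵇ-refl k = T⇒≡true (ℕ.≡⇒≡ᵇ k k refl)

≢⇒≡ᵇ-false : ∀ {k l} → k ≢ l → (k ≡ᵇ l) ≡ false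
≢⇒≡ᵇ-false {k} {l} k≢l = ¬T⇒≡false (k≢l ∘ ℕ.≡ᵇ⇒≡ k l)

≥⇒<ᵇ-false : ∀ {k l} → l ≤ k → (k <ᵇ l) ≡ false
≥⇒<ᵇ-false {k} {l} l≤k = ¬T⇒≡false (λ t → ℕ.<⇒≱ (ℕ.<ᵇ⇒< k l t) l≤k)

≰ᵇ⇒> : ∀ {m n} → T (not (m ≤ᵇ n)) → n < m
≰ᵇ⇒> {m} {n} t = ℕ.≰⇒> λ m≤n → subst T (Equivalence.to Data.Bool.Properties.T-not-≡ t) (ℕ.≤⇒≤ᵇ m≤n)

<⇒≰ᵇ : ∀ {m n} → n < m → T (not (m ≤ᵇ n))
<⇒≰ᵇ {m} {n} n<m =
  Equivalence.from Data.Bool.Properties.T-not-≡ (¬T⇒≡false λ t → ℕ.<⇒≱ n<m (ℕ.≤ᵇ⇒≤ m n t))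

T-not-∨ : ∀ a b → T (not (a ∨ b)) ⇔ (T (not a) × T (not b))
T-not-∨ false b = mk⇔ (_ ,_) proj₂
T-not-∨ true  b = mk⇔ (λ ()) (λ ())

T-∧³ : ∀ {a b c} → T (a ∧ (b ∧ c)) ⇔ (T a × T b × T c)
T-∧³ {false}        = mk⇔ (λ ()) proj₁
T-∧³ {true} {false} = mk⇔ (λ ()) (proj₁ ∘ proj₂)
T-∧³ {true} {true}  = mk⇔ (λ t → _ , _ , t) (proj₂ ∘ proj₂)

between : ℕ → ℕ → ℕ → Bool
between l a i = (l ≤ᵇ i) ∧ not (a ≤ᵇ i)

between⇒< : ∀ {l a i} → T (between l a i) → i < a
between⇒< {l} t = ≰ᵇ⇒> (proj₂ (Equivalence.to (Data.Bool.Properties.T-∧ {l ≤ᵇ _}) t))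

T-allB : ∀ (p : A → Bool) L → T (allB p L) ⇔ All (T ∘ p) L
T-allB p L = mk⇔ (to L) (from L)
  where
  to : ∀ L → T (allB p L) → All (T ∘ p) L
  to []      _ = []
  to (a ∷ L) t = let (pa , rest) = Equivalence.to Data.Bool.Properties.T-∧ t in pa ∷ to L rest
  from : ∀ L → All (T ∘ p) L → T (allB p L)
  from []      []         = _
  from (a ∷ L) (pa ∷ all) = Equivalence.from Data.Bool.Properties.T-∧ (pa , from L all)

∑ : List A → (A → ℤ) → ℤ
∑ L f = sumℤ (map f L)

∑-cong : ∀ (L : List A) {f g : A → ℤ} → (∀ a → f a ≡ g a) → ∑ L f ≡ ∑ L g
∑-cong L f≗g = cong sumℤ (List.map-cong f≗g L)

∑-zero : ∀ (L : List A) → ∑ L (const 0ℤ) ≡ 0ℤ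
∑-zero []      = refl
∑-zero (_ ∷ L) = trans (ℤ.+-identityˡ _) (∑-zero L)

∑-+ : ∀ (L : List A) f g → ∑ L (λ a → f a + g a) ≡ ∑ L f + ∑ L g
∑-+ []      f g = refl
∑-+ (a ∷ L) f g rewrite ∑-+ L f g = +-Comm.interchange (f a) (g a) (∑ L f) (∑ L g)

∑-*ˡ : ∀ (L : List A) c f → ∑ L (λ a → c * f a) ≡ c * ∑ L f
∑-*ˡ []      c f = sym (ℤ.*-zeroʳ c)
∑-*ˡ (a ∷ L) c f rewrite ∑-*ˡ L c f = sym (ℤ.*-distribˡ-+ c (f a) (∑ L f))

∑-*ʳ : ∀ (L : List A) f c → ∑ L (λ a → f a * c) ≡ ∑ L f * c
∑-*ʳ L f c = trans (∑-cong L λ a → ℤ.*-comm (f a) c) (trans (∑-*ˡ L c f) (ℤ.*-comm c _))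

∑-++ : ∀ (L M : List A) f → ∑ (L ++ M) f ≡ ∑ L f + ∑ M f
∑-++ []      M f = sym (ℤ.+-identityˡ _)
∑-++ (a ∷ L) M f rewrite ∑-++ L M f = sym (ℤ.+-assoc (f a) _ _)

∑-map : ∀ (L : List B) (g : B → A) f → ∑ (map g L) f ≡ ∑ L (f ∘ g)
∑-map L g f = cong sumℤ (sym (List.map-∘ L))

∑-concatMap : ∀ (L : List B) (g : B → List A) f →
  ∑ (concatMap g L) f ≡ ∑ L (λ b → ∑ (g b) f)
∑-concatMap []      g f = refl
∑-concatMap (b ∷ L) g f = trans (∑-++ (g b) _ f) (cong (∑ (g b) f +_) (∑-concatMap L g f))

∑-comm : ∀ (L : List A) (M : List B) (f : A → B → ℤ) →
  ∑ L (λ a → ∑ M (f a)) ≡ ∑ M (λ b → ∑ L (λ a → f a b))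
∑-comm []      M f = sym (∑-zero M)
∑-comm (a ∷ L) M f rewrite ∑-comm L M f = sym (∑-+ M (f a) _)

∑-↭ : ∀ {L M : List A} f → L ↭ M → ∑ L f ≡ ∑ M f
∑-↭ f L↭M = foldr-commMonoid ℤ+.setoid ℤ+.isCommutativeMonoid (↭⇒↭ₛ (↭.map⁺ f L↭M))
  where module ℤ+ = CommutativeMonoid ℤ.+-0-commutativeMonoid

∑-unique : ∀ {L M : List A} f → Unique L → Unique M → (∀ {a} → a ∈ L ⇔ a ∈ M) → ∑ L f ≡ ∑ M f
∑-unique f uL uM L≈M = ∑-↭ f (∼bag⇒↭ (unique∧set⇒bag uL uM L≈M))

prodℤ-↭ : ∀ {L M} → L ↭ M → prodℤ L ≡ prodℤ M
prodℤ-↭ L↭M = foldr-commMonoid ℤ*.setoid ℤ*.isCommutativeMonoid (↭⇒↭ₛ L↭M)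
  where module ℤ* = CommutativeMonoid ℤ.*-1-commutativeMonoid

infixr 8 [_]·_

[_]·_ : Bool → ℤ → ℤ
[ b ]· y = if b then y else 0ℤ

[]·-zero : ∀ b → [ b ]· 0ℤ ≡ 0ℤ
[]·-zero true  = refl
[]·-zero false = refl

[]·-*ˡ : ∀ b c y → c * [ b ]· y ≡ [ b ]· (c * y)
[]·-*ˡ true  c y = refl
[]·-*ˡ false c y = ℤ.*-zeroʳ c

[]·-∧ : ∀ a b y → [ a ∧ b ]· y ≡ [ a ]· [ b ]· y
[]·-∧ true  b y = refl
[]·-∧ false b y = refl

[]·-∑ : ∀ b (L : List A) f → [ b ]· (∑ L f) ≡ ∑ L (λ a → [ b ]· f a)
[]·-∑ true  L f = refl
[]·-∑ false L f = sym (∑-zero L)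

[]·-cong : ∀ b {y z} → (T b → y ≡ z) → [ b ]· y ≡ [ b ]· z
[]·-cong true  y≡z = y≡z _
[]·-cong false y≡z = refl

[]·-∧-* : ∀ p q y → [ p ∧ q ]· y ≡ [ p ]· (y * [ q ]· 1ℤ)
[]·-∧-* false q     y = refl
[]·-∧-* true  true  y = sym (ℤ.*-identityʳ y)
[]·-∧-* true  false y = sym (ℤ.*-zeroʳ y)

[]·-rearrange : ∀ p q r y z → [ (p ∧ q) ∧ r ]· (y * z) ≡ [ p ]· (y * [ r ]· [ q ]· z)
[]·-rearrange false q     r     y z = refl
[]·-rearrange true  true  true  y z = refl
[]·-rearrange true  true  false y z = sym (ℤ.*-zeroʳ y)
[]·-rearrange true  false true  y z = sym (ℤ.*-zeroʳ y)
[]·-rearrange true  false false y z = sym (ℤ.*-zeroʳ y)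

[]·-split : ∀ p q y → (T q → T p) → [ p ]· y ≡ [ q ]· y + [ p ∧ not q ]· y
[]·-split true  true  y _   = sym (ℤ.+-identityʳ y)
[]·-split true  false y _   = sym (ℤ.+-identityˡ y)
[]·-split false true  y q⇒p with () ← q⇒p _
[]·-split false false y _   = refl

[]·-swap : ∀ p q a b c → [ p ]· (a * [ q ]· (b * c)) ≡ [ q ]· (b * [ p ]· (a * c))
[]·-swap true  true  a b c = *-Comm.x∙yz≈y∙xz a b c
[]·-swap true  false a b c = ℤ.*-zeroʳ a
[]·-swap false true  a b c = sym (ℤ.*-zeroʳ b)
[]·-swap false false a b c = refl

[]·-+ : ∀ p y z → [ p ]· (y + z) ≡ [ p ]· y + [ p ]· z
[]·-+ true  y z = refl
[]·-+ false y z = refl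

[]·-distrib : ∀ p a r s → [ p ]· (a * (r + s)) ≡ [ p ]· a * r + [ p ]· (a * s)
[]·-distrib true  a r s = ℤ.*-distribˡ-+ a r s
[]·-distrib false a r s = refl

[]·-*ʳ : ∀ p a r → [ p ]· a * r ≡ [ p ]· (a * r)
[]·-*ʳ true  a r = refl
[]·-*ʳ false a r = ℤ.*-zeroˡ r

[]·-complement : ∀ p c a g → [ p ]· (a * g) ≡ [ p ]· (a * [ not c ]· g) + [ p ]· (a * [ c ]· g)
[]·-complement false c     a g = refl
[]·-complement true  true  a g = trans (sym (ℤ.+-identityˡ (a * g))) (cong (_+ a * g) (sym (ℤ.*-zeroʳ a)))
[]·-complement true  false a g = trans (sym (ℤ.+-identityʳ (a * g))) (cong (a * g +_) (sym (ℤ.*-zeroʳ a)))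

module _ {n : ℕ} where

  Σw : ℕ → (List (Fin n) → ℤ) → ℤ
  Σw zero    f = f []
  Σw (suc k) f = ∑ (allFin n) λ i → Σw k (f ∘ (i ∷_))

  Σw-cong : ∀ k {f g : List (Fin n) → ℤ} → (∀ w → length w ≡ k → f w ≡ g w) → Σw k f ≡ Σw k g
  Σw-cong zero    f≗g = f≗g [] refl
  Σw-cong (suc k) f≗g = ∑-cong (allFin n) λ i → Σw-cong k λ w eq → f≗g (i ∷ w) (cong suc eq)

  Σw-zero : ∀ k → Σw k (const 0ℤ) ≡ 0ℤ
  Σw-zero zero    = refl
  Σw-zero (suc k) = trans (∑-cong (allFin n) λ _ → Σw-zero k) (∑-zero (allFin n))

  Σw-+ : ∀ k f g → Σw k (λ w → f w + g w) ≡ Σw k f + Σw k g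
  Σw-+ zero    f g = refl
  Σw-+ (suc k) f g = trans (∑-cong (allFin n) λ i → Σw-+ k _ _) (∑-+ (allFin n) _ _)

  Σw-*ˡ : ∀ k c f → Σw k (λ w → c * f w) ≡ c * Σw k f
  Σw-*ˡ zero    c f = refl
  Σw-*ˡ (suc k) c f = trans (∑-cong (allFin n) λ i → Σw-*ˡ k c _) (∑-*ˡ (allFin n) c _)

  Σw-[]· : ∀ k b f → Σw k (λ w → [ b ]· f w) ≡ [ b ]· (Σw k f)
  Σw-[]· k true  f = refl
  Σw-[]· k false f = Σw-zero k

  Σw-∑ : ∀ k (L : List A) (f : A → List (Fin n) → ℤ) →
    Σw k (λ w → ∑ L λ a → f a w) ≡ ∑ L λ a → Σw k (f a)
  Σw-∑ zero    L f = refl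
  Σw-∑ (suc k) L f = trans (∑-cong (allFin n) λ i → Σw-∑ k L λ a w → f a (i ∷ w)) (∑-comm (allFin n) L _)

  Σw-++ : ∀ p q f → Σw (p ℕ.+ q) f ≡ Σw p λ u → Σw q λ w → f (u ++ w)
  Σw-++ zero    q f = refl
  Σw-++ (suc p) q f = ∑-cong (allFin n) λ i → Σw-++ p q (f ∘ (i ∷_))

  Σw-*ʳ : ∀ k (f : List (Fin n) → ℤ) c → Σw k (λ w → f w * c) ≡ Σw k f * c
  Σw-*ʳ k f c = trans (Σw-cong k λ w _ → ℤ.*-comm (f w) c) (trans (Σw-*ˡ k c f) (ℤ.*-comm c _))

  Σw-[]·-∑ : ∀ k (p : List (Fin n) → Bool) (α : List (Fin n) → ℤ)
           (L : List A) (c : A → Bool) (β : A → ℤ) (Φ : A → List (Fin n) → ℤ) →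
    Σw k (λ u → [ p u ]· (α u * ∑ L λ j → [ c j ]· (β j * Φ j u))) ≡
    ∑ L λ j → [ c j ]· (β j * Σw k λ u → [ p u ]· (α u * Φ j u))
  Σw-[]·-∑ k p α L c β Φ = begin
    Σw k (λ u → [ p u ]· (α u * ∑ L λ j → [ c j ]· (β j * Φ j u)))
      ≡⟨ Σw-cong k (λ u _ → swap u) ⟩
    Σw k (λ u → ∑ L λ j → [ c j ]· (β j * [ p u ]· (α u * Φ j u)))
      ≡⟨ Σw-∑ k L (λ j u → [ c j ]· (β j * [ p u ]· (α u * Φ j u))) ⟩
    (∑ L λ j → Σw k λ u → [ c j ]· (β j * [ p u ]· (α u * Φ j u)))
      ≡⟨ ∑-cong L (λ j → trans (Σw-[]· k (c j) _)
                               (cong [ c j ]·_ (Σw-*ˡ k (β j) λ u → [ p u ]· (α u * Φ j u)))) ⟩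
    (∑ L λ j → [ c j ]· (β j * Σw k λ u → [ p u ]· (α u * Φ j u))) ∎
    where
    open ≡-Reasoning
    swap : ∀ u → [ p u ]· (α u * ∑ L λ j → [ c j ]· (β j * Φ j u)) ≡
                 ∑ L λ j → [ c j ]· (β j * [ p u ]· (α u * Φ j u))
    swap u = begin
      [ p u ]· (α u * ∑ L λ j → [ c j ]· (β j * Φ j u))
        ≡⟨ cong [ p u ]·_ (sym (∑-*ˡ L (α u) λ j → [ c j ]· (β j * Φ j u))) ⟩
      [ p u ]· (∑ L λ j → α u * [ c j ]· (β j * Φ j u))
        ≡⟨ []·-∑ (p u) L (λ j → α u * [ c j ]· (β j * Φ j u)) ⟩
      (∑ L λ j → [ p u ]· (α u * [ c j ]· (β j * Φ j u)))
        ≡⟨ ∑-cong L (λ j → []·-swap (p u) (c j) (α u) (β j) (Φ j u)) ⟩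
      (∑ L λ j → [ c j ]· (β j * [ p u ]· (α u * Φ j u))) ∎

  ∑-words : ∀ k (f : List (Fin n) → ℤ) → sumℤ (map (f ∘ toList) (words n k)) ≡ Σw k f
  ∑-words zero    f = ℤ.+-identityʳ (f [])
  ∑-words (suc k) f = begin
    ∑ (concatMap (λ i → map (i Vec.∷_) (words n k)) (allFin n)) (f ∘ toList)
      ≡⟨ ∑-concatMap (allFin n) _ _ ⟩
    (∑ (allFin n) λ i → ∑ (map (i Vec.∷_) (words n k)) (f ∘ toList))
      ≡⟨ ∑-cong (allFin n) (λ i → trans (∑-map (words n k) (i Vec.∷_) _) (∑-words k (f ∘ (i ∷_)))) ⟩
    Σw (suc k) f ∎
    where open ≡-Reasoning

incrFrom : ∀ {n} → ℕ → List (Fin n) → Bool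
incrFrom l []      = true
incrFrom l (i ∷ w) = (l ≤ᵇ toℕ i) ∧ incrFrom (toℕ i) w

lastOr : ∀ {n} → ℕ → List (Fin n) → ℕ
lastOr l []      = l
lastOr l (i ∷ w) = lastOr (toℕ i) w

incrFrom-++ : ∀ {n} l (u w : List (Fin n)) → incrFrom l (u ++ w) ≡ incrFrom l u ∧ incrFrom (lastOr l u) w
incrFrom-++ l []      w = refl
incrFrom-++ l (i ∷ u) w rewrite incrFrom-++ (toℕ i) u w = sym (Data.Bool.Properties.∧-assoc (l ≤ᵇ toℕ i) _ _)

weaklyIncr≡incrFrom : ∀ {n k} (v : Vec (Fin n) k) → weaklyIncr v ≡ incrFrom 0 (toList v)
weaklyIncr≡incrFrom Vec.[]      = refl
weaklyIncr≡incrFrom (i Vec.∷ v) = go i v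
  where
  go : ∀ {n k} (i : Fin n) (v : Vec (Fin n) k) → weaklyIncr (i Vec.∷ v) ≡ incrFrom (toℕ i) (toList v)
  go i Vec.[]       = refl
  go i (j Vec.∷ v) = cong ((toℕ i ≤ᵇ toℕ j) ∧_) (go j v)

module _ {n : ℕ} (x : Fin n → ℤ) where

  monomial-++ : ∀ u w → monomial x (u ++ w) ≡ monomial x u * monomial x w
  monomial-++ []      w = sym (ℤ.*-identityˡ _)
  monomial-++ (i ∷ u) w rewrite monomial-++ u w = sym (ℤ.*-assoc (x i) _ _)

  Σw-incrFrom-∷ : ∀ k l (F : List (Fin n) → ℤ) →
    Σw (suc k) (λ w → [ incrFrom l w ]· (monomial x w * F w)) ≡
    ∑ (allFin n) λ i → [ l ≤ᵇ toℕ i ]· (x i * Σw k (λ w → [ incrFrom (toℕ i) w ]· (monomial x w * F (i ∷ w))))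
  Σw-incrFrom-∷ k l F = ∑-cong (allFin n) λ i → begin
    Σw k (λ w → [ (l ≤ᵇ toℕ i) ∧ incrFrom (toℕ i) w ]· (x i * monomial x w * F (i ∷ w)))
      ≡⟨ Σw-cong k (λ w _ → trans ([]·-∧ (l ≤ᵇ toℕ i) _ _) (cong ([ l ≤ᵇ toℕ i ]·_) (peel i w))) ⟩
    Σw k (λ w → [ l ≤ᵇ toℕ i ]· (x i * [ incrFrom (toℕ i) w ]· (monomial x w * F (i ∷ w))))
      ≡⟨ trans (Σw-[]· k (l ≤ᵇ toℕ i) _) (cong ([ l ≤ᵇ toℕ i ]·_) (Σw-*ˡ k (x i) _)) ⟩
    [ l ≤ᵇ toℕ i ]· (x i * Σw k (λ w → [ incrFrom (toℕ i) w ]· (monomial x w * F (i ∷ w)))) ∎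
    where
    open ≡-Reasoning
    peel : ∀ i w → [ incrFrom (toℕ i) w ]· (x i * monomial x w * F (i ∷ w))
                 ≡ x i * [ incrFrom (toℕ i) w ]· (monomial x w * F (i ∷ w))
    peel i w = trans (cong ([ incrFrom (toℕ i) w ]·_) (ℤ.*-assoc (x i) (monomial x w) (F (i ∷ w))))
                     (sym ([]·-*ˡ (incrFrom (toℕ i) w) (x i) _))

  Σw-incrFrom-++ : ∀ p q l (F : List (Fin n) → ℤ) →
    Σw (p ℕ.+ q) (λ z → [ incrFrom l z ]· (monomial x z * F z)) ≡
    Σw p (λ v → [ incrFrom l v ]· (monomial x v * Σw q λ w → [ incrFrom (lastOr l v) w ]· (monomial x w * F (v ++ w))))
  Σw-incrFrom-++ p q l F = trans (Σw-++ p q _) (Σw-cong p λ v _ →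
    trans (Σw-cong q (λ w _ → split v w))
          (trans (Σw-[]· q (incrFrom l v) _) (cong [ incrFrom l v ]·_ (Σw-*ˡ q (monomial x v) _))))
    where
    split : ∀ v w → [ incrFrom l (v ++ w) ]· (monomial x (v ++ w) * F (v ++ w)) ≡
                    [ incrFrom l v ]· (monomial x v * [ incrFrom (lastOr l v) w ]· (monomial x w * F (v ++ w)))
    split v w = begin
      [ incrFrom l (v ++ w) ]· (monomial x (v ++ w) * F (v ++ w))
        ≡⟨ cong₂ [_]·_ (incrFrom-++ l v w) (cong (_* F (v ++ w)) (monomial-++ v w)) ⟩
      [ incrFrom l v ∧ incrFrom (lastOr l v) w ]· (monomial x v * monomial x w * F (v ++ w))
        ≡⟨ []·-∧ (incrFrom l v) _ _ ⟩
      [ incrFrom l v ]· [ incrFrom (lastOr l v) w ]· (monomial x v * monomial x w * F (v ++ w))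
        ≡⟨ cong [ incrFrom l v ]·_ (trans (cong [ incrFrom (lastOr l v) w ]·_ (ℤ.*-assoc (monomial x v) _ _))
                                          (sym ([]·-*ˡ (incrFrom (lastOr l v) w) (monomial x v) _))) ⟩
      [ incrFrom l v ]· (monomial x v * [ incrFrom (lastOr l v) w ]· (monomial x w * F (v ++ w))) ∎
      where open ≡-Reasoning

  -- h_k(x_l, …, x_{n-1}), the variables indexed from 0
  hFrom : ℕ → ℕ → ℤ
  hFrom k l = Σw k λ w → [ incrFrom l w ]· monomial x w

  h≡hFrom : ∀ k → h n x k ≡ hFrom k 0
  h≡hFrom k = trans (cong sumℤ (List.map-cong (λ v → cong ([_]· monomial x (toList v)) (weaklyIncr≡incrFrom v)) (words n k)))
                    (∑-words k λ w → [ incrFrom 0 w ]· monomial x w)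

  hFrom-∷ : ∀ k l → hFrom (suc k) l ≡ ∑ (allFin n) λ i → [ l ≤ᵇ toℕ i ]· (x i * hFrom k (toℕ i))
  hFrom-∷ k l = trans (Σw-cong (suc k) λ w _ → cong ([ incrFrom l w ]·_) (sym (ℤ.*-identityʳ (monomial x w))))
                (trans (Σw-incrFrom-∷ k l (const 1ℤ))
                       (∑-cong (allFin n) λ i → cong (λ t → [ l ≤ᵇ toℕ i ]· (x i * t))
                         (Σw-cong k λ w _ → cong ([ incrFrom (toℕ i) w ]·_) (ℤ.*-identityʳ (monomial x w)))))

  hFrom-split : ∀ k {l a} → l ≤ a →
    hFrom (suc k) l ≡ hFrom (suc k) a + ∑ (allFin n) λ i → [ between l a (toℕ i) ]· (x i * hFrom k (toℕ i))
  hFrom-split k {l} {a} l≤a = begin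
    hFrom (suc k) l
      ≡⟨ hFrom-∷ k l ⟩
    (∑ (allFin n) λ i → [ l ≤ᵇ toℕ i ]· (x i * hFrom k (toℕ i)))
      ≡⟨ ∑-cong (allFin n) (λ i → []·-split (l ≤ᵇ toℕ i) (a ≤ᵇ toℕ i) _ (a≤i⇒l≤i i)) ⟩
    (∑ (allFin n) λ i → [ a ≤ᵇ toℕ i ]· (x i * hFrom k (toℕ i)) + [ between l a (toℕ i) ]· (x i * hFrom k (toℕ i)))
      ≡⟨ ∑-+ (allFin n) _ _ ⟩
    (∑ (allFin n) λ i → [ a ≤ᵇ toℕ i ]· (x i * hFrom k (toℕ i))) + correction
      ≡⟨ cong (_+ correction) (sym (hFrom-∷ k a)) ⟩
    hFrom (suc k) a + correction ∎
    where
    open ≡-Reasoning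
    correction = ∑ (allFin n) λ i → [ between l a (toℕ i) ]· (x i * hFrom k (toℕ i))
    a≤i⇒l≤i : ∀ i → T (a ≤ᵇ toℕ i) → T (l ≤ᵇ toℕ i)
    a≤i⇒l≤i i a≤i = ℕ.≤⇒≤ᵇ (ℕ.≤-trans l≤a (ℕ.≤ᵇ⇒≤ a (toℕ i) a≤i))

-- clash u w: some entry of u is ≤ the entry of w in the same position,
-- i.e. u placed directly below w violates strictness in some column.
clash : ∀ {n} → List (Fin n) → List (Fin n) → Bool
clash (i ∷ u) (j ∷ w) = (toℕ i ≤ᵇ toℕ j) ∨ clash u w
clash _       _       = false

-- G w weighs the rows above a row w; by G-∷ it only depends on the last o
-- entries of w, the ones lying below the next row.
module ClashSums {n : ℕ} (x : Fin n → ℤ) (o : ℕ) (G : List (Fin n) → ℤ)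
                 (G-∷ : ∀ i w → o ≤ length w → G (i ∷ w) ≡ G w) where

  rowSum : ℕ → ℕ → ℤ
  rowSum b l = Σw b λ w → [ incrFrom l w ]· (monomial x w * G w)

  clashRow : ℕ → ℕ → List (Fin n) → (List (Fin n) → ℤ) → ℤ
  clashRow b l u g = Σw b λ w → [ incrFrom l w ]· (monomial x w * [ clash u w ]· g w)

  clashSum : ℕ → ℕ → ℕ → ℕ → ℤ
  clashSum k b lu lw = Σw k λ u → [ incrFrom lu u ]· (monomial x u * clashRow b lw u G)

  laterClash : ℕ → ℕ → ℕ → List (Fin n) → ℤ
  laterClash b l a u = ∑ (allFin n) λ j → [ between l a (toℕ j) ]· (x j * clashRow b (toℕ j) u (G ∘ (j ∷_)))

  rowSum-∷ : ∀ b l → o ≤ b → rowSum (suc b) l ≡ ∑ (allFin n) λ i → [ l ≤ᵇ toℕ i ]· (x i * rowSum b (toℕ i))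
  rowSum-∷ b l o≤b = trans (Σw-incrFrom-∷ x b l G) (∑-cong (allFin n) λ i →
    cong (λ t → [ l ≤ᵇ toℕ i ]· (x i * t)) (Σw-cong b λ w |w| →
      cong (λ g → [ incrFrom (toℕ i) w ]· (monomial x w * g)) (G-∷ i w (subst (o ≤_) (sym |w|) o≤b))))

  clashRow-[] : ∀ b l g → clashRow b l [] g ≡ 0ℤ
  clashRow-[] b l g = trans (Σw-cong b λ w _ → noClash w) (Σw-zero b)
    where
    noClash : ∀ w → [ incrFrom l w ]· (monomial x w * [ clash [] w ]· g w) ≡ 0ℤ
    noClash []      = ℤ.*-zeroʳ 1ℤ
    noClash (i ∷ w) = trans (cong [ incrFrom l (i ∷ w) ]·_ (ℤ.*-zeroʳ (monomial x (i ∷ w))))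
                            ([]·-zero (incrFrom l (i ∷ w)))

  laterClash-[] : ∀ b l a → laterClash b l a [] ≡ 0ℤ
  laterClash-[] b l a = trans (∑-cong (allFin n) noClash) (∑-zero (allFin n))
    where
    noClash : ∀ j → [ between l a (toℕ j) ]· (x j * clashRow b (toℕ j) [] (G ∘ (j ∷_))) ≡ 0ℤ
    noClash j = begin
      [ between l a (toℕ j) ]· (x j * clashRow b (toℕ j) [] (G ∘ (j ∷_)))
        ≡⟨ cong (λ t → [ between l a (toℕ j) ]· (x j * t)) (clashRow-[] b (toℕ j) (G ∘ (j ∷_))) ⟩
      [ between l a (toℕ j) ]· (x j * 0ℤ)
        ≡⟨ cong [ between l a (toℕ j) ]·_ (ℤ.*-zeroʳ (x j)) ⟩
      [ between l a (toℕ j) ]· 0ℤ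
        ≡⟨ []·-zero _ ⟩
      0ℤ ∎
      where open ≡-Reasoning

  -- either the first column clashes (i ≤ j), or the clash comes later (j < i)
  clashRow-∷ : ∀ b {l} i u → l ≤ toℕ i →
    clashRow (suc b) l (i ∷ u) G ≡ rowSum (suc b) (toℕ i) + laterClash b l (toℕ i) u
  clashRow-∷ b {l} i u l≤i = begin
    clashRow (suc b) l (i ∷ u) G
      ≡⟨ Σw-incrFrom-∷ x b l (λ w → [ clash (i ∷ u) w ]· G w) ⟩
    (∑ (allFin n) λ j → [ l ≤ᵇ toℕ j ]· (x j * clashRest j))
      ≡⟨ ∑-cong (allFin n) firstColumn ⟩
    (∑ (allFin n) λ j → [ toℕ i ≤ᵇ toℕ j ]· (x j * rest j) + later j)
      ≡⟨ ∑-+ (allFin n) _ later ⟩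
    (∑ (allFin n) λ j → [ toℕ i ≤ᵇ toℕ j ]· (x j * rest j)) + ∑ (allFin n) later
      ≡⟨ cong (_+ ∑ (allFin n) later) (sym (Σw-incrFrom-∷ x b (toℕ i) G)) ⟩
    rowSum (suc b) (toℕ i) + laterClash b l (toℕ i) u ∎
    where
    open ≡-Reasoning
    clashRest rest : Fin n → ℤ
    clashRest j = Σw b λ w → [ incrFrom (toℕ j) w ]· (monomial x w * [ clash (i ∷ u) (j ∷ w) ]· G (j ∷ w))
    rest      j = Σw b λ w → [ incrFrom (toℕ j) w ]· (monomial x w * G (j ∷ w))
    later : Fin n → ℤ
    later j = [ between l (toℕ i) (toℕ j) ]· (x j * clashRow b (toℕ j) u (G ∘ (j ∷_)))
    firstColumn : ∀ j → [ l ≤ᵇ toℕ j ]· (x j * clashRest j) ≡ [ toℕ i ≤ᵇ toℕ j ]· (x j * rest j) + later j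
    firstColumn j with toℕ i ≤ᵇ toℕ j in i≤j
    ... | true  rewrite ≤ᵇ-true (ℕ.≤-trans l≤i (ℕ.≤ᵇ⇒≤ (toℕ i) (toℕ j) (subst T (sym i≤j) _)))
                = sym (ℤ.+-identityʳ _)
    ... | false rewrite Data.Bool.Properties.∧-identityʳ (l ≤ᵇ toℕ j) = sym (ℤ.+-identityˡ _)

  -- Induction on k: after splitting off the first entry i of u, the clashes
  -- avoiding the first column are those of a shorter u with a row starting
  -- below i, and the correction term of hFrom-split collects them.
  clashSum-factor : ∀ k b {lu lw} → k ≤ b → o ℕ.+ k ≤ suc b → lw ≤ lu →
    clashSum (suc k) (suc b) lu lw ≡ hFrom x k lw * rowSum (suc (suc b)) lu
  firstEntry : ∀ k b {lw} i → k ≤ b → o ℕ.+ k ≤ suc b → lw ≤ toℕ i →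
    Σw k (λ u → [ incrFrom (toℕ i) u ]· (monomial x u * clashRow (suc b) lw (i ∷ u) G)) ≡
    hFrom x k lw * rowSum (suc b) (toℕ i)
  laterClashes : ∀ k b {lw a} → k ≤ b → o ℕ.+ k ≤ suc b → lw ≤ a →
    hFrom x k a * rowSum (suc b) a + Σw k (λ u → [ incrFrom a u ]· (monomial x u * laterClash b lw a u)) ≡
    hFrom x k lw * rowSum (suc b) a

  clashSum-factor k b {lu} {lw} k≤b o+k≤1+b lw≤lu = begin
    clashSum (suc k) (suc b) lu lw
      ≡⟨ Σw-incrFrom-∷ x k lu (λ u → clashRow (suc b) lw u G) ⟩
    (∑ (allFin n) λ i → [ lu ≤ᵇ toℕ i ]· (x i * Σw k λ u →
                           [ incrFrom (toℕ i) u ]· (monomial x u * clashRow (suc b) lw (i ∷ u) G)))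
      ≡⟨ ∑-cong (allFin n) (λ i → []·-cong (lu ≤ᵇ toℕ i) λ lu≤i →
           cong (x i *_) (firstEntry k b i k≤b o+k≤1+b (ℕ.≤-trans lw≤lu (ℕ.≤ᵇ⇒≤ lu (toℕ i) lu≤i)))) ⟩
    (∑ (allFin n) λ i → [ lu ≤ᵇ toℕ i ]· (x i * (H * R i)))
      ≡⟨ ∑-cong (allFin n) (λ i → trans (cong [ lu ≤ᵇ toℕ i ]·_ (*-Comm.x∙yz≈y∙xz (x i) H (R i)))
                                        (sym ([]·-*ˡ (lu ≤ᵇ toℕ i) H (x i * R i)))) ⟩
    (∑ (allFin n) λ i → H * [ lu ≤ᵇ toℕ i ]· (x i * R i))
      ≡⟨ ∑-*ˡ (allFin n) H _ ⟩
    H * (∑ (allFin n) λ i → [ lu ≤ᵇ toℕ i ]· (x i * R i))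
      ≡⟨ cong (H *_) (sym (rowSum-∷ (suc b) lu (ℕ.≤-trans (ℕ.m≤m+n o k) o+k≤1+b))) ⟩
    H * rowSum (suc (suc b)) lu ∎
    where
    open ≡-Reasoning
    H = hFrom x k lw
    R : Fin n → ℤ
    R i = rowSum (suc b) (toℕ i)

  firstEntry k b {lw} i k≤b o+k≤1+b lw≤i = begin
    Σw k (λ u → [ incrFrom a u ]· (monomial x u * clashRow (suc b) lw (i ∷ u) G))
      ≡⟨ Σw-cong k (λ u _ → cong (λ t → [ incrFrom a u ]· (monomial x u * t)) (clashRow-∷ b i u lw≤i)) ⟩
    Σw k (λ u → [ incrFrom a u ]· (monomial x u * (R + laterClash b lw a u)))
      ≡⟨ Σw-cong k (λ u _ → []·-distrib (incrFrom a u) (monomial x u) R _) ⟩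
    Σw k (λ u → [ incrFrom a u ]· monomial x u * R + later u)
      ≡⟨ Σw-+ k _ later ⟩
    Σw k (λ u → [ incrFrom a u ]· monomial x u * R) + Σw k later
      ≡⟨ cong (_+ Σw k later) (Σw-*ʳ k _ R) ⟩
    hFrom x k a * R + Σw k later
      ≡⟨ laterClashes k b k≤b o+k≤1+b lw≤i ⟩
    hFrom x k lw * R ∎
    where
    open ≡-Reasoning
    a = toℕ i
    R = rowSum (suc b) a
    later : List (Fin n) → ℤ
    later u = [ incrFrom a u ]· (monomial x u * laterClash b lw a u)

  laterClashes zero b {lw} {a} _ _ _ =
    trans (cong (λ t → hFrom x 0 a * rowSum (suc b) a + 1ℤ * t) (laterClash-[] b lw a)) (ℤ.+-identityʳ _)
  laterClashes (suc k) (suc b) {lw} {a} (s≤s k≤b) o+1+k≤2+b lw≤a = begin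
    hFrom x (suc k) a * R + Σw (suc k) (λ u → [ incrFrom a u ]· (monomial x u * laterClash (suc b) lw a u))
      ≡⟨ cong (hFrom x (suc k) a * R +_) (Σw-cong (suc k) λ u _ →
           cong (λ t → [ incrFrom a u ]· (monomial x u * t)) (laterClash-G u)) ⟩
    hFrom x (suc k) a * R +
      Σw (suc k) (λ u → [ incrFrom a u ]· (monomial x u * ∑ (allFin n) λ j → [ below j ]· (x j * clash′ j u)))
      ≡⟨ cong (hFrom x (suc k) a * R +_) (Σw-[]·-∑ (suc k) (incrFrom a) (monomial x) (allFin n) below x clash′) ⟩
    hFrom x (suc k) a * R + (∑ (allFin n) λ j → [ below j ]· (x j * clashSum (suc k) (suc b) a (toℕ j)))
      ≡⟨ cong (hFrom x (suc k) a * R +_) (∑-cong (allFin n) λ j → []·-cong (below j) λ j-below →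
           cong (x j *_) (clashSum-factor k b {a} k≤b o+k≤1+b (ℕ.<⇒≤ (between⇒< {lw} {a} j-below)))) ⟩
    hFrom x (suc k) a * R + (∑ (allFin n) λ j → [ below j ]· (x j * (hFrom x k (toℕ j) * R)))
      ≡⟨ cong (hFrom x (suc k) a * R +_) (trans (∑-cong (allFin n) λ j → pull-R j) (∑-*ʳ (allFin n) _ R)) ⟩
    hFrom x (suc k) a * R + correction * R
      ≡⟨ sym (ℤ.*-distribʳ-+ R (hFrom x (suc k) a) correction) ⟩
    (hFrom x (suc k) a + correction) * R
      ≡⟨ cong (_* R) (sym (hFrom-split x k lw≤a)) ⟩
    hFrom x (suc k) lw * R ∎
    where
    open ≡-Reasoning
    R = rowSum (suc (suc b)) a
    o+k≤1+b : o ℕ.+ k ≤ suc b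
    o+k≤1+b = ℕ.≤-pred (subst (_≤ suc (suc b)) (ℕ.+-suc o k) o+1+k≤2+b)
    below : Fin n → Bool
    below j = between lw a (toℕ j)
    clash′ : Fin n → List (Fin n) → ℤ
    clash′ j u = clashRow (suc b) (toℕ j) u G
    correction : ℤ
    correction = ∑ (allFin n) λ j → [ below j ]· (x j * hFrom x k (toℕ j))
    pull-R : ∀ j → [ below j ]· (x j * (hFrom x k (toℕ j) * R)) ≡ [ below j ]· (x j * hFrom x k (toℕ j)) * R
    pull-R j = trans (cong [ below j ]·_ (sym (ℤ.*-assoc (x j) _ R))) (sym ([]·-*ʳ (below j) _ R))
    laterClash-G : ∀ u → laterClash (suc b) lw a u ≡ ∑ (allFin n) λ j → [ below j ]· (x j * clash′ j u)
    laterClash-G u = ∑-cong (allFin n) λ j → cong (λ t → [ below j ]· (x j * t)) (Σw-cong (suc b) λ w |w| →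
      cong (λ g → [ incrFrom (toℕ j) w ]· (monomial x w * [ clash u w ]· g))
           (G-∷ j w (subst (o ≤_) (sym |w|) (ℕ.≤-trans (ℕ.m≤m+n o k) o+k≤1+b))))

  G-++ : ∀ u w → o ≤ length w → G (u ++ w) ≡ G w
  G-++ []      w o≤w = refl
  G-++ (i ∷ u) w o≤w = trans (G-∷ i (u ++ w) (subst (o ≤_) (sym (List.length-++ u)) (ℕ.≤-trans o≤w (ℕ.m≤n+m _ _))))
                             (G-++ u w o≤w)

  -- only the last k + 1 entries of u lie below the next row
  clashSum-prefix : ∀ p k b → k < b → o ℕ.+ k ≤ b →
    Σw (p ℕ.+ suc k) (λ u → [ incrFrom 0 u ]· (monomial x u * clashRow b 0 (lastN (suc k) u) G)) ≡
    hFrom x k 0 * rowSum (p ℕ.+ suc b) 0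
  clashSum-prefix p k (suc b) (s≤s k≤b) o+k≤1+b = begin
    Σw (p ℕ.+ suc k) (λ u → [ incrFrom 0 u ]· (monomial x u * clashRow (suc b) 0 (lastN (suc k) u) G))
      ≡⟨ Σw-incrFrom-++ x p (suc k) 0 _ ⟩
    Σw p (λ v → [ incrFrom 0 v ]· (monomial x v * Σw (suc k) λ u →
                  [ incrFrom (lastOr 0 v) u ]· (monomial x u * clashRow (suc b) 0 (lastN (suc k) (v ++ u)) G)))
      ≡⟨ Σw-cong p (λ v _ → cong (λ t → [ incrFrom 0 v ]· (monomial x v * t)) (Σw-cong (suc k) λ u |u| →
           cong (λ u′ → [ incrFrom (lastOr 0 v) u ]· (monomial x u * clashRow (suc b) 0 u′ G)) (lastN-++-length v u |u|))) ⟩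
    Σw p (λ v → [ incrFrom 0 v ]· (monomial x v * clashSum (suc k) (suc b) (lastOr 0 v) 0))
      ≡⟨ Σw-cong p (λ v _ → cong (λ t → [ incrFrom 0 v ]· (monomial x v * t))
                                 (clashSum-factor k b {lastOr 0 v} k≤b o+k≤1+b z≤n)) ⟩
    Σw p (λ v → [ incrFrom 0 v ]· (monomial x v * (H * R v)))
      ≡⟨ Σw-cong p (λ v _ → trans (cong [ incrFrom 0 v ]·_ (*-Comm.x∙yz≈y∙xz (monomial x v) H (R v)))
                                  (sym ([]·-*ˡ (incrFrom 0 v) H _))) ⟩
    Σw p (λ v → H * [ incrFrom 0 v ]· (monomial x v * R v))
      ≡⟨ Σw-*ˡ p H _ ⟩
    H * Σw p (λ v → [ incrFrom 0 v ]· (monomial x v * R v))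
      ≡⟨ cong (H *_) (Σw-cong p λ v _ → cong (λ t → [ incrFrom 0 v ]· (monomial x v * t))
           (Σw-cong (suc (suc b)) λ w |w| → cong (λ g → [ incrFrom (lastOr 0 v) w ]· (monomial x w * g))
             (sym (G-++ v w (subst (o ≤_) (sym |w|) o≤2+b))))) ⟩
    H * Σw p (λ v → [ incrFrom 0 v ]· (monomial x v * Σw (suc (suc b)) λ w →
                      [ incrFrom (lastOr 0 v) w ]· (monomial x w * G (v ++ w))))
      ≡⟨ cong (H *_) (sym (Σw-incrFrom-++ x p (suc (suc b)) 0 G)) ⟩
    H * rowSum (p ℕ.+ suc (suc b)) 0 ∎
    where
    open ≡-Reasoning
    H = hFrom x k 0
    R : List (Fin n) → ℤ
    R v = rowSum (suc (suc b)) (lastOr 0 v)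
    o≤2+b : o ≤ suc (suc b)
    o≤2+b = ℕ.≤-trans (ℕ.m≤m+n o k) (ℕ.≤-trans o+k≤1+b (ℕ.n≤1+n _))

upperOverlap : ℕ → BDC → ℕ
upperOverlap m ⟨ _ ⟩        = 0
upperOverlap m (_ ∷⟨ δ ⟩ _) = ovl m δ

module RowFillings {n : ℕ} (x : Fin n → ℤ) (m : ℕ) where

  -- schurRows D c: the skew Schur function of D restricted to fillings whose
  -- bottom row u satisfies c u; schurAbove D u: the fillings of the rows
  -- above a given bottom row u, which only see the last entries of u.
  schurRows  : BDC → (List (Fin n) → Bool) → ℤ
  schurAbove : BDC → List (Fin n) → ℤ

  schurRows D c = Σw (head D) λ u → [ incrFrom 0 u ]· (monomial x u * [ c u ]· schurAbove D u)

  schurAbove ⟨ _ ⟩        u = 1ℤ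
  schurAbove (_ ∷⟨ δ ⟩ B) u = schurRows B λ w → not (clash (lastN (ovl m δ) u) w)

  schurAbove-∷ : ∀ D i u → upperOverlap m D ≤ length u → schurAbove D (i ∷ u) ≡ schurAbove D u
  schurAbove-∷ ⟨ _ ⟩        i u _   = refl
  schurAbove-∷ (_ ∷⟨ δ ⟩ B) i u o≤u = cong (λ v → schurRows B λ w → not (clash v w)) (lastN-∷ (ovl m δ) i u o≤u)

  s : BDC → ℤ
  s D = schurRows D (const true)

  module Above (B : BDC) = ClashSums x (upperOverlap m B) (schurAbove B) (schurAbove-∷ B)

  s-clash : ∀ B v → s B ≡ schurRows B (λ w → not (clash v w)) + Above.clashRow B (head B) 0 v (schurAbove B)
  s-clash B v = trans (Σw-cong (head B) λ w _ → []·-complement (incrFrom 0 w) (clash v w) (monomial x w) (schurAbove B w))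
                      (Σw-+ (head B) _ _)

  -- h_a s_B - s_{a δ B} counts the fillings whose two bottom rows clash,
  -- which clashSum-prefix identifies with h_{o-1} s_{merged}
  s-∷ : ∀ p k δ B → ovl m δ ≡ suc k → k < head B → upperOverlap m B ℕ.+ k ≤ head B →
    hFrom x (p ℕ.+ suc k) 0 * s B ≡ s ((p ℕ.+ suc k) ∷⟨ δ ⟩ B) + hFrom x k 0 * Above.rowSum B (p ℕ.+ suc (head B)) 0
  s-∷ p k δ B o≡1+k k<b o′+k≤b = begin
    hFrom x a 0 * s B
      ≡⟨ sym (Σw-*ʳ a _ (s B)) ⟩
    Σw a (λ u → [ incrFrom 0 u ]· monomial x u * s B)
      ≡⟨ Σw-cong a (λ u _ → trans ([]·-*ʳ (incrFrom 0 u) (monomial x u) (s B))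
                                  (cong (λ t → [ incrFrom 0 u ]· (monomial x u * t)) (s-clash B (lastN o u)))) ⟩
    Σw a (λ u → [ incrFrom 0 u ]· (monomial x u * (noClash u + clashes o u)))
      ≡⟨ Σw-cong a (λ u _ → trans (cong [ incrFrom 0 u ]·_ (ℤ.*-distribˡ-+ (monomial x u) _ _)) ([]·-+ (incrFrom 0 u) _ _)) ⟩
    Σw a (λ u → [ incrFrom 0 u ]· (monomial x u * noClash u) + [ incrFrom 0 u ]· (monomial x u * clashes o u))
      ≡⟨ Σw-+ a _ _ ⟩
    s (a ∷⟨ δ ⟩ B) + Σw a (λ u → [ incrFrom 0 u ]· (monomial x u * clashes o u))
      ≡⟨ cong (λ o′ → s (a ∷⟨ δ ⟩ B) + Σw a (λ u → [ incrFrom 0 u ]· (monomial x u * clashes o′ u))) o≡1+k ⟩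
    s (a ∷⟨ δ ⟩ B) + Σw a (λ u → [ incrFrom 0 u ]· (monomial x u * clashes (suc k) u))
      ≡⟨ cong (s (a ∷⟨ δ ⟩ B) +_) (clashSum-prefix p k (head B) k<b o′+k≤b) ⟩
    s (a ∷⟨ δ ⟩ B) + hFrom x k 0 * rowSum (p ℕ.+ suc (head B)) 0 ∎
    where
    open ≡-Reasoning
    open Above B
    a = p ℕ.+ suc k
    o = ovl m δ
    noClash : List (Fin n) → ℤ
    noClash u = schurRows B λ w → not (clash (lastN o u) w)
    clashes : ℕ → List (Fin n) → ℤ
    clashes o′ u = clashRow (head B) 0 (lastN o′ u) (schurAbove B)

Filled : ℕ → Set
Filled n = (ℕ × ℕ) × Fin n

module _ {n : ℕ} where

  row col entry : Filled n → ℕ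
  row   ((r , _) , _) = r
  col   ((_ , c) , _) = c
  entry (_ , v)       = toℕ v

  Compatible : List (Filled n) → List (Filled n) → Set
  Compatible X Y = All (λ p → All (λ q → T (compatible p q)) Y) X

  Semistandard : List (Filled n) → Set
  Semistandard X = Compatible X X

  T-semistandard : ∀ X → T (semistandard X) ⇔ Semistandard X
  T-semistandard X = mk⇔
    (λ t → All.map (Equivalence.to (T-allB _ X)) (Equivalence.to (T-allB _ X) t))
    (λ ss → Equivalence.from (T-allB _ X) (All.map (Equivalence.from (T-allB _ X)) ss))

  Compatible-[] : ∀ X → Compatible X []
  Compatible-[] X = All.universal (λ _ → []) X

  Compatible-++ʳ : ∀ X Y Z → Compatible X (Y ++ Z) ⇔ (Compatible X Y × Compatible X Z)
  Compatible-++ʳ X Y Z = mk⇔ (All.unzip ∘ All.map (Allₚ.++⁻ Y)) (All.map (uncurry Allₚ.++⁺) ∘ All.zip)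

  Semistandard-++ : ∀ X Y → Semistandard (X ++ Y) ⇔ ((Semistandard X × Semistandard Y) × (Compatible X Y × Compatible Y X))
  Semistandard-++ X Y = mk⇔ to from
    where
    to : Semistandard (X ++ Y) → (Semistandard X × Semistandard Y) × (Compatible X Y × Compatible Y X)
    to ss with Allₚ.++⁻ X ss
    ... | fromX , fromY with Equivalence.to (Compatible-++ʳ X X Y) fromX | Equivalence.to (Compatible-++ʳ Y X Y) fromY
    ... | XX , XY | YX , YY = (XX , YY) , (XY , YX)
    from : (Semistandard X × Semistandard Y) × (Compatible X Y × Compatible Y X) → Semistandard (X ++ Y)
    from ((XX , YY) , (XY , YX)) =
      Allₚ.++⁺ (Equivalence.from (Compatible-++ʳ X X Y) (XX , XY)) (Equivalence.from (Compatible-++ʳ Y X Y) (YX , YY))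

  compatible-≢ : ∀ p q → row p ≢ row q → col p ≢ col q → T (compatible p q)
  compatible-≢ ((r , c) , _) ((r′ , c′) , _) r≢r′ c≢c′
    rewrite ≢⇒≡ᵇ-false r≢r′ | ≢⇒≡ᵇ-false c≢c′ = _

  compatible-higher : ∀ p q → row q < row p → T (compatible p q)
  compatible-higher ((r , c) , _) ((r′ , c′) , _) r′<r
    rewrite ≢⇒≡ᵇ-false (ℕ.>⇒≢ r′<r) | ≥⇒<ᵇ-false (ℕ.<⇒≤ r′<r)
          | Data.Bool.Properties.∧-zeroʳ (c ≡ᵇ c′) = _

  compatible-lower⁺ : ∀ p q → row p < row q → (col p ≡ col q → entry q < entry p) → T (compatible p q)
  compatible-lower⁺ ((r , c) , _) ((r′ , c′) , _) r<r′ strict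
    rewrite ≢⇒≡ᵇ-false (ℕ.<⇒≢ r<r′) | T⇒≡true (ℕ.<⇒<ᵇ r<r′) with c ≡ᵇ c′ in c≡c′
  ... | true  = ℕ.<⇒<ᵇ (strict (ℕ.≡ᵇ⇒≡ c c′ (subst T (sym c≡c′) _)))
  ... | false = _

  compatible-lower⁻ : ∀ p q → row p < row q → col p ≡ col q → T (compatible p q) → entry q < entry p
  compatible-lower⁻ ((r , c) , v) ((r′ , .c) , v′) r<r′ refl t
    rewrite ≢⇒≡ᵇ-false (ℕ.<⇒≢ r<r′) | ≡ᵇ-refl c | T⇒≡true (ℕ.<⇒<ᵇ r<r′)
    = ℕ.<ᵇ⇒< (toℕ v′) (toℕ v) t

  compatible-row⁺ : ∀ p q → row p ≡ row q → (col p < col q → entry p ≤ entry q) → T (compatible p q)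
  compatible-row⁺ ((r , c) , _) ((.r , c′) , _) refl weak
    rewrite ≡ᵇ-refl r | ≥⇒<ᵇ-false (ℕ.≤-refl {r}) | Data.Bool.Properties.∧-zeroʳ (c ≡ᵇ c′)
    with c <ᵇ c′ in c<c′
  ... | true  = Equivalence.from Data.Bool.Properties.T-∧
                  (ℕ.≤⇒≤ᵇ (weak (ℕ.<ᵇ⇒< c c′ (subst T (sym c<c′) _))) , _)
  ... | false = _

  compatible-row⁻ : ∀ p q → row p ≡ row q → col p < col q → T (compatible p q) → entry p ≤ entry q
  compatible-row⁻ ((r , c) , v) ((.r , c′) , v′) refl c<c′ t
    rewrite ≡ᵇ-refl r | T⇒≡true (ℕ.<⇒<ᵇ c<c′)
    = ℕ.≤ᵇ⇒≤ (toℕ v) (toℕ v′) (proj₁ (Equivalence.to Data.Bool.Properties.T-∧ t))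

rowCells : ℕ → ℕ → ℕ → List (ℕ × ℕ)
rowCells r c zero    = []
rowCells r c (suc k) = (r , c) ∷ rowCells r (suc c) k

length-rowCells : ∀ r c k → length (rowCells r c k) ≡ k
length-rowCells r c zero    = refl
length-rowCells r c (suc k) = cong suc (length-rowCells r (suc c) k)

rowCells-upTo : ∀ r c k → map (λ t → (r , c ℕ.+ t)) (upTo k) ≡ rowCells r c k
rowCells-upTo r c k = trans (List.map-upTo (λ t → (r , c ℕ.+ t)) k) (go c k (λ t → refl))
  where
  go : ∀ c k {f : ℕ → ℕ × ℕ} → (∀ t → f t ≡ (r , c ℕ.+ t)) → applyUpTo f k ≡ rowCells r c k
  go c zero    f≗ = refl
  go c (suc k) f≗ = cong₂ _∷_ (trans (f≗ 0) (cong (r ,_) (ℕ.+-identityʳ c)))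
                              (go (suc c) k λ t → trans (f≗ (suc t)) (cong (r ,_) (ℕ.+-suc c t)))

rowCells-within : ∀ r c k → All (λ q → proj₁ q ≡ r × c ≤ proj₂ q) (rowCells r c k)
rowCells-within r c zero    = []
rowCells-within r c (suc k) = (refl , ℕ.≤-refl) ∷ All.map (Product.map₂ ℕ.<⇒≤) (rowCells-within r (suc c) k)

∈-rowCells : ∀ r s k {c} → s ≤ c → c < s ℕ.+ k → (r , c) ∈ rowCells r s k
∈-rowCells r s zero    {c} s≤c c<s+0 = ⊥-elim (ℕ.<⇒≱ c<s+0 (subst (_≤ c) (sym (ℕ.+-identityʳ s)) s≤c))
∈-rowCells r s (suc k) {c} s≤c c<s+k with s ℕ.≟ c
... | yes refl = here refl
... | no  s≢c  = there (∈-rowCells r (suc s) k (ℕ.≤∧≢⇒< s≤c s≢c) (subst (c <_) (ℕ.+-suc s k) c<s+k))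

module _ {n : ℕ} where

  filledRow : ℕ → ℕ → List (Fin n) → List (Filled n)
  filledRow r c []      = []
  filledRow r c (i ∷ u) = ((r , c) , i) ∷ filledRow r (suc c) u

  zip-rowCells : ∀ r c (u : List (Fin n)) → zip (rowCells r c (length u)) u ≡ filledRow r c u
  zip-rowCells r c []      = refl
  zip-rowCells r c (i ∷ u) = cong (((r , c) , i) ∷_) (zip-rowCells r (suc c) u)

  filledRow-within : ∀ r c u → All (λ p → row p ≡ r × c ≤ col p × col p < c ℕ.+ length u) (filledRow r c u)
  filledRow-within r c []      = []
  filledRow-within r c (i ∷ u) = (refl , ℕ.≤-refl , ℕ.m<m+n c (s≤s z≤n))
    ∷ All.map (λ {p} (r≡ , c< , <end) → r≡ , ℕ.<⇒≤ c< , subst (col p <_) (sym (ℕ.+-suc c (length u))) <end)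
              (filledRow-within r (suc c) u)

  filledRow-column : ∀ r c u {c₀} → c ≤ c₀ → c₀ < c ℕ.+ length u → ∃[ v ] ((r , c₀) , v) ∈ filledRow r c u
  filledRow-column r c []      c≤c₀ c₀<c+0 = ⊥-elim (ℕ.<⇒≱ c₀<c+0 (subst (_≤ _) (sym (ℕ.+-identityʳ c)) c≤c₀))
  filledRow-column r c (i ∷ u) {c₀} c≤c₀ c₀<end with c ℕ.≟ c₀
  ... | yes refl = i , here refl
  ... | no  c≢c₀ = Product.map₂ there
    (filledRow-column r (suc c) u (ℕ.≤∧≢⇒< c≤c₀ c≢c₀) (subst (c₀ <_) (ℕ.+-suc c (length u)) c₀<end))

  zip-All₁ : ∀ {P : ℕ × ℕ → Set} (X : List (ℕ × ℕ)) (u : List (Fin n)) → All P X → All (P ∘ proj₁) (zip X u)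
  zip-All₁ []      u       []         = []
  zip-All₁ (c ∷ X) []      _          = []
  zip-All₁ (c ∷ X) (i ∷ u) (Pc ∷ PX) = Pc ∷ zip-All₁ X u PX

  filledRow-entries : ∀ {P : Fin n → Set} r c u → All P u → All (P ∘ proj₂) (filledRow r c u)
  filledRow-entries r c []      []         = []
  filledRow-entries r c (i ∷ u) (Pi ∷ Pu) = Pi ∷ filledRow-entries r (suc c) u Pu

  incrFrom-All : ∀ l (u : List (Fin n)) → T (incrFrom l u) → All (λ j → l ≤ toℕ j) u
  incrFrom-All l []      _ = []
  incrFrom-All l (i ∷ u) t with Equivalence.to Data.Bool.Properties.T-∧ t
  ... | l≤i , rest = ℕ.≤ᵇ⇒≤ l (toℕ i) l≤i
                   ∷ All.map (ℕ.≤-trans (ℕ.≤ᵇ⇒≤ l (toℕ i) l≤i)) (incrFrom-All (toℕ i) u rest)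

  Semistandard-row⁺ : ∀ r c l u → T (incrFrom l u) → Semistandard (filledRow r c u)
  Semistandard-row⁺ r c l []      _ = []
  Semistandard-row⁺ r c l (i ∷ u) t =
    (firstVsFirst ∷ firstVsRest) ∷ All.zipWith (uncurry _∷_) (restVsFirst , Semistandard-row⁺ r (suc c) (toℕ i) u incrU)
    where
    first = ((r , c) , i)
    incrU = proj₂ (Equivalence.to Data.Bool.Properties.T-∧ t)
    rest-within = filledRow-within r (suc c) u
    firstVsRest : All (λ q → T (compatible first q)) (filledRow r (suc c) u)
    firstVsRest = All.zipWith (λ {q} ((r≡ , _) , i≤q) → compatible-row⁺ first q (sym r≡) (const i≤q))
                  (rest-within , filledRow-entries r (suc c) u (incrFrom-All (toℕ i) u incrU))
    firstVsFirst : T (compatible first first)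
    firstVsFirst = compatible-row⁺ first first refl (λ c<c → ⊥-elim (ℕ.<-irrefl refl c<c))
    restVsFirst : All (λ p → T (compatible p first)) (filledRow r (suc c) u)
    restVsFirst = All.map (λ {p} (r≡ , c< , _) → compatible-row⁺ p first r≡ (λ c<c → ⊥-elim (ℕ.<-asym c<c c<)))
                          rest-within

  Semistandard-row⁻ : ∀ r c u → Semistandard (filledRow r c u) → T (incrFrom 0 u)
  Semistandard-row⁻ r c []          _ = _
  Semistandard-row⁻ r c (i ∷ [])    _ = _
  Semistandard-row⁻ r c (i ∷ j ∷ u) ((_ ∷ i≼j ∷ _) ∷ rest) = Equivalence.from Data.Bool.Properties.T-∧
    ( ℕ.≤⇒≤ᵇ (compatible-row⁻ ((r , c) , i) ((r , suc c) , j) refl ℕ.≤-refl i≼j)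
    , Semistandard-row⁻ r (suc c) (j ∷ u) (All.map All.tail rest))

  semistandard-row : ∀ r c u → semistandard (filledRow r c u) ≡ incrFrom 0 u
  semistandard-row r c u = T-ext (⇔.trans (T-semistandard _) (mk⇔ (Semistandard-row⁻ r c u) (Semistandard-row⁺ r c 0 u)))

  Compatible-aligned : ∀ r c u w → Compatible (filledRow r c u) (filledRow (suc r) c w) ⇔ T (not (clash u w))
  Compatible-aligned r c []      w       = mk⇔ _ (const [])
  Compatible-aligned r c (i ∷ u) []      = mk⇔ _ (const (Compatible-[] (filledRow r c (i ∷ u))))
  Compatible-aligned r c (i ∷ u) (j ∷ w) = mk⇔
    (λ { ((below ∷ _) ∷ rest) → Equivalence.from (T-not-∨ (toℕ i ≤ᵇ toℕ j) _)
           (<⇒≰ᵇ (compatible-lower⁻ p q (ℕ.n<1+n r) refl below) , Equivalence.to IH (All.map All.tail rest)) })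
    (λ t → let (i≰j , noClash) = Equivalence.to (T-not-∨ (toℕ i ≤ᵇ toℕ j) _) t in
           (compatible-lower⁺ p q (ℕ.n<1+n r) (const (≰ᵇ⇒> i≰j)) ∷ pVsW)
           ∷ All.zipWith (uncurry _∷_) (uVsq , Equivalence.from IH noClash))
    where
    p = ((r , c) , i)
    q = ((suc r , c) , j)
    IH = Compatible-aligned r (suc c) u w
    pVsW : All (λ q′ → T (compatible p q′)) (filledRow (suc r) (suc c) w)
    pVsW = All.map (λ {q′} (r≡ , c< , _) → compatible-≢ p q′ (λ r≡r′ → ℕ.1+n≢n (sym (trans r≡r′ r≡)))
                                                              (ℕ.<⇒≢ c<))
                   (filledRow-within (suc r) (suc c) w)
    uVsq : All (λ p′ → T (compatible p′ q)) (filledRow r (suc c) u)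
    uVsq = All.map (λ {p′} (r≡ , c< , _) → compatible-≢ p′ q (λ r′≡1+r → ℕ.1+n≢n (sym (trans (sym r≡) r′≡1+r)))
                                                              (ℕ.>⇒≢ c<))
                   (filledRow-within r (suc c) u)

  -- row r ends o columns after row r + 1 starts
  Compatible-overlap : ∀ r c u c′ w {o} → o ≤ length u → c ℕ.+ length u ≡ c′ ℕ.+ o →
    Compatible (filledRow r c u) (filledRow (suc r) c′ w) ⇔ T (not (clash (lastN o u) w))
  Compatible-overlap r c u c′ w o≤u end≡ with ℕ.m≤n⇒m<n∨m≡n o≤u
  ... | inj₂ refl rewrite ℕ.+-cancelʳ-≡ (length u) c c′ end≡ | lastN-++-length [] u refl = Compatible-aligned r c′ u w
  Compatible-overlap r c (i ∷ u) c′ w {o} _ end≡ | inj₁ (s≤s o≤u) = mk⇔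
    (λ { (_ ∷ rest) → subst (λ v → T (not (clash v w))) (sym (lastN-∷ o i u o≤u)) (Equivalence.to IH rest) })
    (λ t → pVsW ∷ Equivalence.from IH (subst (λ v → T (not (clash v w))) (lastN-∷ o i u o≤u) t))
    where
    IH = Compatible-overlap r (suc c) u c′ w o≤u (trans (sym (ℕ.+-suc c (length u))) end≡)
    c<c′ : c < c′
    c<c′ = ℕ.+-cancelʳ-≤ (length u) (suc c) c′
             (ℕ.≤-trans (ℕ.≤-reflexive (trans (sym (ℕ.+-suc c (length u))) end≡)) (ℕ.+-monoʳ-≤ c′ o≤u))
    pVsW : All (λ q → T (compatible ((r , c) , i) q)) (filledRow (suc r) c′ w)
    pVsW = All.map (λ {q} (r≡ , c′≤ , _) → compatible-≢ ((r , c) , i) q (λ r≡r′ → ℕ.1+n≢n (sym (trans r≡r′ r≡)))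
                                                                         (ℕ.<⇒≢ (ℕ.<-≤-trans c<c′ c′≤)))
                   (filledRow-within (suc r) c′ w)

  -- a cell of row r sharing its column with a cell of a row above r + 1 also
  -- shares it with a cell of row r + 1, whose entry lies strictly in between
  Compatible-through : ∀ r c u c′ w (Z : List (Filled n)) {o} → o ≤ length w → c′ ℕ.+ o ≡ c ℕ.+ length u →
    All (λ q → suc (suc r) ≤ row q × c′ ≤ col q) Z →
    Compatible (filledRow r c u) (filledRow (suc r) c′ w) → Compatible (filledRow (suc r) c′ w) Z →
    Compatible (filledRow r c u) Z
  Compatible-through r c u c′ w Z o≤w end≡ Z-within uVsw wVsZ =
    All.zipWith (λ {p} ((r≡ , _ , <end) , pVsw) → cellVsZ p r≡ <end pVsw) (filledRow-within r c u , uVsw)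
    where
    cellVsZ : ∀ p → row p ≡ r → col p < c ℕ.+ length u → All (λ q → T (compatible p q)) (filledRow (suc r) c′ w) →
              All (λ q → T (compatible p q)) Z
    cellVsZ p r≡ <end pVsw with c′ ℕ.≤? col p
    ... | no c′≰ = All.map (λ {q} (above , c′≤) → compatible-≢ p q
                              (λ p≡q → ℕ.<⇒≢ (ℕ.<-trans (ℕ.n<1+n r) above) (trans (sym r≡) p≡q))
                              (λ p≡q → c′≰ (subst (c′ ≤_) (sym p≡q) c′≤)))
                           Z-within
    ... | yes c′≤ with filledRow-column (suc r) c′ w c′≤
                         (ℕ.<-≤-trans <end (subst (_≤ c′ ℕ.+ length w) end≡ (ℕ.+-monoʳ-≤ c′ o≤w)))
    ... | v , middle∈ = All.zipWith (λ {q} ((above , _) , middleVsq) → compatible-lower⁺ p q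
                              (subst (_< row q) (sym r≡) (ℕ.<-trans (ℕ.n<1+n r) above))
                              (λ p≡q → ℕ.<-trans (compatible-lower⁻ middle q above p≡q middleVsq)
                                                 (compatible-lower⁻ p middle (subst (_< suc r) (sym r≡) (ℕ.n<1+n r)) refl
                                                                    (All.lookup pVsw middle∈))))
                           (Z-within , All.lookup wVsZ middle∈)
      where
      middle : Filled n
      middle = ((suc r , col p) , v)

  Semistandard-stack : ∀ r s u s′ w Z {o} → o ≤ length u → o ≤ length w → s ℕ.+ length u ≡ s′ ℕ.+ o →
    All (λ q → suc (suc r) ≤ row q × s′ ≤ col q) Z →
    Semistandard (filledRow r s u ++ (filledRow (suc r) s′ w ++ Z)) ⇔
    (T (incrFrom 0 u) × Semistandard (filledRow (suc r) s′ w ++ Z) × T (not (clash (lastN o u) w)))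
  Semistandard-stack r s u s′ w Z {o} o≤u o≤w end≡ Z-above = mk⇔ to from
    where
    X = filledRow r s u
    W = filledRow (suc r) s′ w
    uw = Compatible-overlap r s u s′ w o≤u end≡
    to : Semistandard (X ++ (W ++ Z)) → T (incrFrom 0 u) × Semistandard (W ++ Z) × T (not (clash (lastN o u) w))
    to ss with Equivalence.to (Semistandard-++ X (W ++ Z)) ss
    ... | (ssX , ssWZ) , (XvsWZ , _) =
      Semistandard-row⁻ r s u ssX , ssWZ , Equivalence.to uw (proj₁ (Equivalence.to (Compatible-++ʳ X W Z) XvsWZ))
    from : T (incrFrom 0 u) × Semistandard (W ++ Z) × T (not (clash (lastN o u) w)) → Semistandard (X ++ (W ++ Z))
    from (incrU , ssWZ , noClash) = Equivalence.from (Semistandard-++ X (W ++ Z))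
      ((Semistandard-row⁺ r s 0 u incrU , ssWZ) , (Equivalence.from (Compatible-++ʳ X W Z) (XvsW , XvsZ) , WZvsX))
      where
      XvsW : Compatible X W
      XvsW = Equivalence.from uw noClash
      XvsZ : Compatible X Z
      XvsZ = Compatible-through r s u s′ w Z o≤w (sym end≡) Z-above XvsW
               (proj₁ (proj₂ (Equivalence.to (Semistandard-++ W Z) ssWZ)))
      WZ-above : All (λ q → suc r ≤ row q) (W ++ Z)
      WZ-above = Allₚ.++⁺ (All.map (λ (r≡ , _) → ℕ.≤-reflexive (sym r≡)) (filledRow-within (suc r) s′ w))
                          (All.map (λ (above , _) → ℕ.<⇒≤ above) Z-above)
      WZvsX : Compatible (W ++ Z) X
      WZvsX = All.map (λ {q} above → All.map (λ {p} (r≡ , _) → compatible-higher q p (subst (_< row q) (sym r≡) above))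
                                             (filledRow-within r s u))
                      WZ-above

size : BDC → ℕ
size ⟨ a ⟩        = a
size (a ∷⟨ _ ⟩ B) = a ℕ.+ size B

head≤size : ∀ D → head D ≤ size D
head≤size ⟨ a ⟩        = ℕ.≤-refl
head≤size (a ∷⟨ _ ⟩ B) = ℕ.m≤m+n a (size B)

data OverlapsFit (m : ℕ) : BDC → Set where
  single : ∀ {a} → OverlapsFit m ⟨ a ⟩
  cons   : ∀ {a δ B} → ovl m δ ≤ a → ovl m δ ≤ head B → OverlapsFit m B → OverlapsFit m (a ∷⟨ δ ⟩ B)

module Diagram (m : ℕ) where

  placed : ℕ → ℕ → BDC → List (ℕ × ℕ)
  placed r s D = cellsOfRows r (rowsFrom m s D)

  placedAbove : ℕ → ℕ → BDC → List (ℕ × ℕ)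
  placedAbove r s ⟨ _ ⟩        = []
  placedAbove r s (a ∷⟨ δ ⟩ B) = placed (suc r) (s ℕ.+ a ∸ ovl m δ) B

  placed-split : ∀ r s D → placed r s D ≡ rowCells r s (head D) ++ placedAbove r s D
  placed-split r s ⟨ a ⟩        = cong (_++ []) (rowCells-upTo r s a)
  placed-split r s (a ∷⟨ δ ⟩ B) = cong (_++ placedAbove r s (a ∷⟨ δ ⟩ B)) (rowCells-upTo r s a)

  length-placed : ∀ r s D → length (placed r s D) ≡ size D
  length-placed r s D rewrite placed-split r s D | List.length-++ (rowCells r s (head D)) {placedAbove r s D}
                            | length-rowCells r s (head D) with D
  ... | ⟨ a ⟩        = ℕ.+-identityʳ a
  ... | a ∷⟨ δ ⟩ B = cong (a ℕ.+_) (length-placed (suc r) (s ℕ.+ a ∸ ovl m δ) B)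

  placed-within      : ∀ r s D → OverlapsFit m D → All (λ q → r ≤ proj₁ q × s ≤ proj₂ q) (placed r s D)
  placedAbove-within : ∀ r s D → OverlapsFit m D → All (λ q → suc r ≤ proj₁ q × s ≤ proj₂ q) (placedAbove r s D)

  placed-within r s D fit = subst (All _) (sym (placed-split r s D))
    (Allₚ.++⁺ (All.map (Product.map₁ (ℕ.≤-reflexive ∘ sym)) (rowCells-within r s (head D)))
              (All.map (Product.map₁ ℕ.<⇒≤) (placedAbove-within r s D fit)))

  placedAbove-within r s ⟨ _ ⟩        single            = []
  placedAbove-within r s (a ∷⟨ δ ⟩ B) (cons o≤a _ fitB) =
    All.map (Product.map₂ (ℕ.≤-trans s≤s′)) (placed-within (suc r) (s ℕ.+ a ∸ ovl m δ) B fitB)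
    where
    s≤s′ : s ≤ s ℕ.+ a ∸ ovl m δ
    s≤s′ = subst (s ≤_) (sym (ℕ.+-∸-assoc s o≤a)) (ℕ.m≤m+n s (a ∸ ovl m δ))

  module _ {n : ℕ} where

    zip-placed : ∀ r s D (v : List (Fin n)) → head D ≤ length v →
      zip (placed r s D) v ≡ filledRow r s (take (head D) v) ++ zip (placedAbove r s D) (drop (head D) v)
    zip-placed r s D v b≤v = begin
      zip (placed r s D) v
        ≡⟨ cong₂ zip (placed-split r s D) (sym (List.take++drop≡id b v)) ⟩
      zip (rowCells r s b ++ placedAbove r s D) (take b v ++ drop b v)
        ≡⟨ zip-++ (rowCells r s b) _ (take b v) _ (trans (length-rowCells r s b) (sym |take|)) ⟩
      zip (rowCells r s b) (take b v) ++ zip (placedAbove r s D) (drop b v)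
        ≡⟨ cong (λ k → zip (rowCells r s k) (take b v) ++ rest) (sym |take|) ⟩
      zip (rowCells r s (length (take b v))) (take b v) ++ zip (placedAbove r s D) (drop b v)
        ≡⟨ cong (_++ rest) (zip-rowCells r s (take b v)) ⟩
      filledRow r s (take b v) ++ zip (placedAbove r s D) (drop b v) ∎
      where
      open ≡-Reasoning
      b = head D
      rest = zip (placedAbove r s D) (drop b v)
      |take| : length (take b v) ≡ b
      |take| = trans (List.length-take b v) (ℕ.m≤n⇒m⊓n≡m b≤v)

    semistandard-∷ : ∀ r s a δ B (u v : List (Fin n)) →
      OverlapsFit m (a ∷⟨ δ ⟩ B) → length u ≡ a → length v ≡ size B →
      semistandard (zip (placed r s (a ∷⟨ δ ⟩ B)) (u ++ v)) ≡
      incrFrom 0 u ∧ (semistandard (zip (placed (suc r) (s ℕ.+ a ∸ ovl m δ) B) v)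
                        ∧ not (clash (lastN (ovl m δ) u) (take (head B) v)))
    semistandard-∷ r s .(length u) δ B u v (cons o≤a o≤b fitB) refl |v|
      rewrite zip-placed r s (length u ∷⟨ δ ⟩ B) (u ++ v) (subst (length u ≤_) (sym (List.length-++ u)) (ℕ.m≤m+n _ _))
            | take-length-++ u v | drop-length-++ u v
            | zip-placed (suc r) (s ℕ.+ length u ∸ ovl m δ) B v (subst (head B ≤_) (sym |v|) (head≤size B))
            = T-ext (⇔.trans (T-semistandard _) (⇔.trans
                (Semistandard-stack r s u s′ (take b v) Z o≤a (subst (ovl m δ ≤_) (sym |take|) o≤b) end≡
                  (zip-All₁ (placedAbove (suc r) s′ B) (drop b v) (placedAbove-within (suc r) s′ B fitB)))
                (⇔.trans (⇔.refl ×-⇔ ⇔.sym (T-semistandard _) ×-⇔ ⇔.refl) (⇔.sym T-∧³))))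
      where
      s′ = s ℕ.+ length u ∸ ovl m δ
      b  = head B
      Z  = zip (placedAbove (suc r) s′ B) (drop b v)
      b≤v : b ≤ length v
      b≤v = subst (b ≤_) (sym |v|) (head≤size B)
      |take| : length (take b v) ≡ b
      |take| = trans (List.length-take b v) (ℕ.m≤n⇒m⊓n≡m b≤v)
      end≡ : s ℕ.+ length u ≡ s′ ℕ.+ ovl m δ
      end≡ = sym (ℕ.m∸n+n≡m (ℕ.≤-trans o≤a (ℕ.m≤n+m (length u) s)))

  module _ {n : ℕ} (x : Fin n → ℤ) where
    open RowFillings x m

    schurRows-semistandard : ∀ D r s (c : List (Fin n) → Bool) → OverlapsFit m D →
      Σw (size D) (λ v → [ semistandard (zip (placed r s D) v) ∧ c (take (head D) v) ]· monomial x v) ≡ schurRows D c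
    schurRows-semistandard ⟨ a ⟩ r s c single = Σw-cong a λ v |v| → begin
      [ semistandard (zip (placed r s ⟨ a ⟩) v) ∧ c (take a v) ]· monomial x v
        ≡⟨ cong (λ cs → [ semistandard (zip cs v) ∧ c (take a v) ]· monomial x v)
                (trans (placed-split r s ⟨ a ⟩) (trans (List.++-identityʳ _) (cong (rowCells r s) (sym |v|)))) ⟩
      [ semistandard (zip (rowCells r s (length v)) v) ∧ c (take a v) ]· monomial x v
        ≡⟨ cong₂ (λ b v′ → [ b ∧ c v′ ]· monomial x v)
                 (trans (cong semistandard (zip-rowCells r s v)) (semistandard-row r s v))
                 (List.take-all a v (ℕ.≤-reflexive |v|)) ⟩
      [ incrFrom 0 v ∧ c v ]· monomial x v
        ≡⟨ []·-∧-* (incrFrom 0 v) (c v) (monomial x v) ⟩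
      [ incrFrom 0 v ]· (monomial x v * [ c v ]· 1ℤ) ∎
      where open ≡-Reasoning
    schurRows-semistandard (a ∷⟨ δ ⟩ B) r s c fit@(cons _ _ fitB) = begin
      Σw (a ℕ.+ size B) (λ v → [ semistandard (zip (placed r s D) v) ∧ c (take a v) ]· monomial x v)
        ≡⟨ Σw-++ a (size B) _ ⟩
      Σw a (λ u → Σw (size B) λ v → [ semistandard (zip (placed r s D) (u ++ v)) ∧ c (take a (u ++ v)) ]· monomial x (u ++ v))
        ≡⟨ Σw-cong a (λ u |u| → Σw-cong (size B) λ v |v| → splitRow u v |u| |v|) ⟩
      Σw a (λ u → Σw (size B) λ v → [ incrFrom 0 u ]· (monomial x u * [ c u ]· [ restOK u v ]· monomial x v))
        ≡⟨ Σw-cong a (λ u _ → trans (Σw-[]· (size B) (incrFrom 0 u) _) (cong [ incrFrom 0 u ]·_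
             (trans (Σw-*ˡ (size B) (monomial x u) _) (cong (monomial x u *_) (Σw-[]· (size B) (c u) _))))) ⟩
      Σw a (λ u → [ incrFrom 0 u ]· (monomial x u * [ c u ]· Σw (size B) λ v → [ restOK u v ]· monomial x v))
        ≡⟨ Σw-cong a (λ u _ → cong (λ t → [ incrFrom 0 u ]· (monomial x u * [ c u ]· t))
                                   (schurRows-semistandard B (suc r) s′ (nonClash u) fitB)) ⟩
      schurRows D c ∎
      where
      open ≡-Reasoning
      D  = a ∷⟨ δ ⟩ B
      s′ = s ℕ.+ a ∸ ovl m δ
      nonClash : List (Fin n) → List (Fin n) → Bool
      nonClash u w = not (clash (lastN (ovl m δ) u) w)
      restOK : List (Fin n) → List (Fin n) → Bool
      restOK u v = semistandard (zip (placed (suc r) s′ B) v) ∧ nonClash u (take (head B) v)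
      splitRow : ∀ u v → length u ≡ a → length v ≡ size B →
        [ semistandard (zip (placed r s D) (u ++ v)) ∧ c (take a (u ++ v)) ]· monomial x (u ++ v) ≡
        [ incrFrom 0 u ]· (monomial x u * [ c u ]· [ restOK u v ]· monomial x v)
      splitRow u v refl |v| = begin
        [ semistandard (zip (placed r s D) (u ++ v)) ∧ c (take a (u ++ v)) ]· monomial x (u ++ v)
          ≡⟨ cong₂ (λ b y → [ b ∧ c (take a (u ++ v)) ]· y) (semistandard-∷ r s a δ B u v fit refl |v|) (monomial-++ x u v) ⟩
        [ (incrFrom 0 u ∧ restOK u v) ∧ c (take a (u ++ v)) ]· (monomial x u * monomial x v)
          ≡⟨ cong (λ u′ → [ (incrFrom 0 u ∧ restOK u v) ∧ c u′ ]· (monomial x u * monomial x v)) (take-length-++ u v) ⟩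
        [ (incrFrom 0 u ∧ restOK u v) ∧ c u ]· (monomial x u * monomial x v)
          ≡⟨ []·-rearrange (incrFrom 0 u) (restOK u v) (c u) (monomial x u) (monomial x v) ⟩
        [ incrFrom 0 u ]· (monomial x u * [ c u ]· [ restOK u v ]· monomial x v) ∎

    skewSchur≡s : ∀ D → OverlapsFit m D → skewSchur m n x D ≡ s D
    skewSchur≡s D fit = begin
      skewSchur m n x D
        ≡⟨ ∑-words (length (cells m D)) (λ v → [ semistandard (zip (cells m D) v) ]· monomial x v) ⟩
      Σw (length (cells m D)) (λ v → [ semistandard (zip (cells m D) v) ]· monomial x v)
        ≡⟨ cong (λ k → Σw k λ v → [ semistandard (zip (cells m D) v) ]· monomial x v) (length-placed 0 0 D) ⟩
      Σw (size D) (λ v → [ semistandard (zip (cells m D) v) ]· monomial x v)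
        ≡⟨ Σw-cong (size D) (λ v _ → cong ([_]· monomial x v) (sym (Data.Bool.Properties.∧-identityʳ _))) ⟩
      Σw (size D) (λ v → [ semistandard (zip (cells m D) v) ∧ true ]· monomial x v)
        ≡⟨ schurRows-semistandard D 0 0 (const true) fit ⟩
      s D ∎
      where open ≡-Reasoning

valid-head : ∀ {m D} → Valid m D → 1 ≤ head D
valid-head (one 1≤a)       = 1≤a
valid-head (cons 1≤a _)    = 1≤a
valid-head (dot 1≤a _ _ _) = 1≤a

valid-tail : ∀ {m a δ B} → Valid m (a ∷⟨ δ ⟩ B) → Valid m B
valid-tail (cons _ v)      = v
valid-tail (dot _ _ _ v) = v

valid-overlaps : ∀ {m a δ B} → Valid m (a ∷⟨ δ ⟩ B) → ovl m δ ≤ a × ovl m δ ≤ head B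
valid-overlaps (cons 1≤a vB)      = 1≤a , valid-head vB
valid-overlaps (dot _ m≤a m≤b _) = m≤a , m≤b

Valid⇒OverlapsFit : ∀ {m D} → Valid m D → OverlapsFit m D
Valid⇒OverlapsFit (one _)             = single
Valid⇒OverlapsFit v@(cons _ vB)      = cons (proj₁ (valid-overlaps v)) (proj₂ (valid-overlaps v)) (Valid⇒OverlapsFit vB)
Valid⇒OverlapsFit v@(dot _ _ _ vB) = cons (proj₁ (valid-overlaps v)) (proj₂ (valid-overlaps v)) (Valid⇒OverlapsFit vB)

-- unlike mergeVal itself (truncated subtraction across box-dots), this is uniform in δ
mergeVal+ovl : ∀ m δ {a} c → ovl m δ ≤ a → mergeVal m δ a c ℕ.+ ovl m δ ≡ a ℕ.+ c ℕ.+ 1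
mergeVal+ovl m false c _       = refl
mergeVal+ovl m true  {a} c m≤a = ℕ.m∸n+n≡m (ℕ.≤-trans m≤a (ℕ.≤-trans (ℕ.m≤m+n a c) (ℕ.m≤m+n (a ℕ.+ c) 1)))

module _ {m a δ B} (v : Valid m (a ∷⟨ δ ⟩ B)) where

  private
    o = ovl m δ
    c = head B
    merged+o : mergeVal m δ a c ℕ.+ o ≡ a ℕ.+ c ℕ.+ 1
    merged+o = mergeVal+ovl m δ c (proj₁ (valid-overlaps v))

  <mergeVal : a < mergeVal m δ a c
  <mergeVal = ℕ.+-cancelʳ-≤ o (suc a) _ (begin
    suc a ℕ.+ o   ≤⟨ s≤s (ℕ.+-monoʳ-≤ a (proj₂ (valid-overlaps v))) ⟩
    suc (a ℕ.+ c) ≡⟨ ℕ.+-comm 1 (a ℕ.+ c) ⟩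
    a ℕ.+ c ℕ.+ 1 ≡⟨ merged+o ⟨
    mergeVal m δ a c ℕ.+ o ∎)
    where open ℕ.≤-Reasoning

  ≤mergeVal : c ≤ mergeVal m δ a c
  ≤mergeVal = ℕ.+-cancelʳ-≤ o c _ (begin
    c ℕ.+ o       ≤⟨ ℕ.+-monoʳ-≤ c (proj₁ (valid-overlaps v)) ⟩
    c ℕ.+ a       ≤⟨ ℕ.m≤m+n (c ℕ.+ a) 1 ⟩
    c ℕ.+ a ℕ.+ 1 ≡⟨ cong (ℕ._+ 1) (ℕ.+-comm c a) ⟩
    a ℕ.+ c ℕ.+ 1 ≡⟨ merged+o ⟨
    mergeVal m δ a c ℕ.+ o ∎)
    where open ℕ.≤-Reasoning

mergeFirst : ℕ → Bool → ℕ → BDC → BDC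
mergeFirst m δ a ⟨ c ⟩        = ⟨ mergeVal m δ a c ⟩
mergeFirst m δ a (c ∷⟨ s ⟩ B) = mergeVal m δ a c ∷⟨ s ⟩ B

head-mergeFirst : ∀ m δ a B → head (mergeFirst m δ a B) ≡ mergeVal m δ a (head B)
head-mergeFirst m δ a ⟨ c ⟩        = refl
head-mergeFirst m δ a (c ∷⟨ s ⟩ B) = refl

valid-mergeFirst : ∀ {m a δ B} → Valid m (a ∷⟨ δ ⟩ B) → Valid m (mergeFirst m δ a B)
valid-mergeFirst {B = ⟨ c ⟩} v = one (ℕ.≤-trans (s≤s z≤n) (<mergeVal v))
valid-mergeFirst {B = c ∷⟨ false ⟩ B′} v with valid-tail v
... | cons _ vB′ = cons (ℕ.≤-trans (s≤s z≤n) (<mergeVal v)) vB′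
valid-mergeFirst {B = c ∷⟨ true ⟩ B′} v with valid-tail v
... | dot _ m≤c m≤d vB′ = dot (ℕ.≤-trans (s≤s z≤n) (<mergeVal v)) (ℕ.≤-trans m≤c (≤mergeVal v)) m≤d vB′

head-Merge : ∀ {m δ S T} → Merge m δ S T → Valid m S → head S ≤ head T
head-Merge here₁     v = ℕ.<⇒≤ (<mergeVal v)
head-Merge here₂     v = ℕ.<⇒≤ (<mergeVal v)
head-Merge (there _) v = ℕ.≤-refl

valid-Merge : ∀ {m δ S T} → Merge m δ S T → Valid m S → Valid m T
valid-Merge here₁     v                    = valid-mergeFirst v
valid-Merge here₂     v                    = valid-mergeFirst v
valid-Merge (there M) (cons 1≤a v)         = cons 1≤a (valid-Merge M v)
valid-Merge (there M) (dot 1≤a m≤a m≤b v) = dot 1≤a m≤a (ℕ.≤-trans m≤b (head-Merge M v)) (valid-Merge M v)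

mergeVal-assoc : ∀ {m s δ a c D} → Valid m (a ∷⟨ s ⟩ (c ∷⟨ δ ⟩ D)) →
  mergeVal m δ (mergeVal m s a c) (head D) ≡ mergeVal m s a (mergeVal m δ c (head D))
mergeVal-assoc {m} {s} {δ} {a} {c} {D} v = ℕ.+-cancelʳ-≡ (oδ ℕ.+ os) _ _ (begin
  mergeVal m δ ac d ℕ.+ (oδ ℕ.+ os)   ≡⟨ ℕ.+-assoc (mergeVal m δ ac d) oδ os ⟨
  mergeVal m δ ac d ℕ.+ oδ ℕ.+ os     ≡⟨ cong (ℕ._+ os) (mergeVal+ovl m δ d (ℕ.≤-trans oδ≤c (≤mergeVal v))) ⟩
  ac ℕ.+ d ℕ.+ 1 ℕ.+ os               ≡⟨ shuffle ac d os ⟩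
  ac ℕ.+ os ℕ.+ d ℕ.+ 1               ≡⟨ cong (λ t → t ℕ.+ d ℕ.+ 1) (mergeVal+ovl m s c os≤a) ⟩
  a ℕ.+ c ℕ.+ 1 ℕ.+ d ℕ.+ 1           ≡⟨ regroup a c d ⟩
  a ℕ.+ (c ℕ.+ d ℕ.+ 1) ℕ.+ 1         ≡⟨ cong (λ t → a ℕ.+ t ℕ.+ 1) (mergeVal+ovl m δ d oδ≤c) ⟨
  a ℕ.+ (cd ℕ.+ oδ) ℕ.+ 1             ≡⟨ shuffle′ a cd oδ ⟩
  a ℕ.+ cd ℕ.+ 1 ℕ.+ oδ               ≡⟨ cong (ℕ._+ oδ) (mergeVal+ovl m s cd os≤a) ⟨
  mergeVal m s a cd ℕ.+ os ℕ.+ oδ     ≡⟨ ℕ.+-assoc (mergeVal m s a cd) os oδ ⟩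
  mergeVal m s a cd ℕ.+ (os ℕ.+ oδ)   ≡⟨ cong (mergeVal m s a cd ℕ.+_) (ℕ.+-comm os oδ) ⟩
  mergeVal m s a cd ℕ.+ (oδ ℕ.+ os)   ∎)
  where
  open ≡-Reasoning
  os = ovl m s
  oδ = ovl m δ
  d  = head D
  ac = mergeVal m s a c
  cd = mergeVal m δ c d
  os≤a = proj₁ (valid-overlaps v)
  oδ≤c = proj₁ (valid-overlaps (valid-tail v))
  shuffle : ∀ x y z → x ℕ.+ y ℕ.+ 1 ℕ.+ z ≡ x ℕ.+ z ℕ.+ y ℕ.+ 1
  shuffle = ℕ-solve-∀
  regroup : ∀ x y z → x ℕ.+ y ℕ.+ 1 ℕ.+ z ℕ.+ 1 ≡ x ℕ.+ (y ℕ.+ z ℕ.+ 1) ℕ.+ 1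
  regroup = ℕ-solve-∀
  shuffle′ : ∀ x y z → x ℕ.+ (y ℕ.+ z) ℕ.+ 1 ≡ x ℕ.+ y ℕ.+ 1 ℕ.+ z
  shuffle′ = ℕ-solve-∀

boxDots : Bool → ℕ
boxDots false = 0
boxDots true  = 1

prepend : ℕ → Bool → Pair → Pair
prepend a δ (S , k) = (a ∷⟨ δ ⟩ S , k)

raise : ℕ → Pair → Pair
raise j (S , k) = (S , j ℕ.+ k)

module Interval (m : ℕ) where

  -- induction in which both B and the merge of the first two parts count as
  -- smaller than a ∷⟨ δ ⟩ B
  merge-ind : (P : BDC → Set) → (∀ a → P ⟨ a ⟩) →
              (∀ a δ B → P B → P (mergeFirst m δ a B) → P (a ∷⟨ δ ⟩ B)) → ∀ D → P D
  merge-ind P base step ⟨ a ⟩        = base a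
  merge-ind P base step (a ∷⟨ δ ⟩ B) = go a δ B
    where
    go : ∀ a δ B → P (a ∷⟨ δ ⟩ B)
    go a δ ⟨ c ⟩        = step a δ ⟨ c ⟩ (base c) (base (mergeVal m δ a c))
    go a δ (c ∷⟨ s ⟩ B) = step a δ (c ∷⟨ s ⟩ B) (go c s B) (go (mergeVal m δ a c) s B)

  -- either the first separator is never merged, or merging it can be done first
  above : BDC → List Pair
  aboveCons : ℕ → Bool → BDC → List Pair
  above ⟨ a ⟩        = [ (⟨ a ⟩ , 0) ]
  above (a ∷⟨ δ ⟩ B) = aboveCons a δ B
  aboveCons a δ ⟨ c ⟩        =
    map (prepend a δ) (above ⟨ c ⟩) ++ map (raise (boxDots δ)) (above ⟨ mergeVal m δ a c ⟩)
  aboveCons a δ (c ∷⟨ s ⟩ B) =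
    map (prepend a δ) (aboveCons c s B) ++ map (raise (boxDots δ)) (aboveCons (mergeVal m δ a c) s B)

  above-∷ : ∀ a δ B →
    above (a ∷⟨ δ ⟩ B) ≡ map (prepend a δ) (above B) ++ map (raise (boxDots δ)) (above (mergeFirst m δ a B))
  above-∷ a δ ⟨ c ⟩        = refl
  above-∷ a δ (c ∷⟨ s ⟩ B) = refl

  ∈-above-∷⁻ : ∀ a δ B {P} → P ∈ above (a ∷⟨ δ ⟩ B) →
    (∃[ Q ] Q ∈ above B × P ≡ prepend a δ Q) ⊎ (∃[ Q ] Q ∈ above (mergeFirst m δ a B) × P ≡ raise (boxDots δ) Q)
  ∈-above-∷⁻ a δ B P∈ with ∈-++⁻ (map (prepend a δ) (above B)) (subst (_ ∈_) (above-∷ a δ B) P∈)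
  ... | inj₁ P∈ˡ = inj₁ (∈-map⁻ (prepend a δ) P∈ˡ)
  ... | inj₂ P∈ʳ = inj₂ (∈-map⁻ (raise (boxDots δ)) P∈ʳ)

  ∈-above-prepend : ∀ a δ B {Q} → Q ∈ above B → prepend a δ Q ∈ above (a ∷⟨ δ ⟩ B)
  ∈-above-prepend a δ B Q∈ = subst (_ ∈_) (sym (above-∷ a δ B)) (∈-++⁺ˡ (∈-map⁺ (prepend a δ) Q∈))

  ∈-above-raise : ∀ a δ B {Q} → Q ∈ above (mergeFirst m δ a B) → raise (boxDots δ) Q ∈ above (a ∷⟨ δ ⟩ B)
  ∈-above-raise a δ B Q∈ =
    subst (_ ∈_) (sym (above-∷ a δ B)) (∈-++⁺ʳ (map (prepend a δ) (above B)) (∈-map⁺ (raise (boxDots δ)) Q∈))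

  self∈above : ∀ D → (D , 0) ∈ above D
  self∈above ⟨ a ⟩        = here refl
  self∈above (a ∷⟨ δ ⟩ B) = ∈-above-prepend a δ B (self∈above B)

  ⪯-prepend : ∀ a δ {P Q} → P ⪯[ m ] Q → prepend a δ P ⪯[ m ] prepend a δ Q
  ⪯-prepend a δ ε                = ε
  ⪯-prepend a δ (plain M ◅ P⪯)  = plain (there M) ◅ ⪯-prepend a δ P⪯
  ⪯-prepend a δ (dotted M ◅ P⪯) = dotted (there M) ◅ ⪯-prepend a δ P⪯

  ⪯-raise : ∀ j {P Q} → P ⪯[ m ] Q → raise j P ⪯[ m ] raise j Q
  ⪯-raise j ε                                = ε
  ⪯-raise j (plain M ◅ P⪯)                  = plain M ◅ ⪯-raise j P⪯
  ⪯-raise j (dotted {S} {T} {k} M ◅ P⪯) =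
    subst (λ k′ → Covers m (S , j ℕ.+ k) (T , k′)) (sym (ℕ.+-suc j k)) (dotted M) ◅ ⪯-raise j P⪯

  covers-mergeFirst : ∀ a δ B → Covers m (a ∷⟨ δ ⟩ B , 0) (mergeFirst m δ a B , boxDots δ)
  covers-mergeFirst a false ⟨ c ⟩        = plain here₁
  covers-mergeFirst a false (c ∷⟨ s ⟩ B) = plain here₂
  covers-mergeFirst a true  ⟨ c ⟩        = dotted here₁
  covers-mergeFirst a true  (c ∷⟨ s ⟩ B) = dotted here₂

  above-sound : ∀ D {P} → P ∈ above D → (D , 0) ⪯[ m ] P
  above-sound = merge-ind Sound base step
    where
    Sound : BDC → Set
    Sound D = ∀ {P} → P ∈ above D → (D , 0) ⪯[ m ] P
    base : ∀ a → Sound ⟨ a ⟩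
    base a (here refl) = ε
    step : ∀ a δ B → Sound B → Sound (mergeFirst m δ a B) → Sound (a ∷⟨ δ ⟩ B)
    step a δ B soundB soundM P∈ with ∈-above-∷⁻ a δ B P∈
    ... | inj₁ (Q , Q∈ , refl) = ⪯-prepend a δ (soundB Q∈)
    ... | inj₂ (Q , Q∈ , refl) = covers-mergeFirst a δ B ◅
          subst (λ k → (mergeFirst m δ a B , k) ⪯[ m ] raise (boxDots δ) Q) (ℕ.+-identityʳ (boxDots δ))
                (⪯-raise (boxDots δ) (soundM Q∈))

  raise-comm : ∀ i j Q → raise i (raise j Q) ≡ raise j (raise i Q)
  raise-comm i j (S , k) = cong (S ,_) (swap i j k)
    where
    swap : ∀ i j k → i ℕ.+ (j ℕ.+ k) ≡ j ℕ.+ (i ℕ.+ k)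
    swap = ℕ-solve-∀

  -- a merge anywhere in S commutes with the enumeration of the pairs above
  above-Merge       : ∀ {δ S T} → Merge m δ S T → Valid m S →
                      ∀ {Q} → Q ∈ above T → raise (boxDots δ) Q ∈ above S
  above-Merge-there : ∀ {δ S T} → Merge m δ S T → ∀ a s → Valid m (a ∷⟨ s ⟩ S) →
                      ∀ {Q} → Q ∈ above (a ∷⟨ s ⟩ T) → raise (boxDots δ) Q ∈ above (a ∷⟨ s ⟩ S)
  above-Merge-first : ∀ {δ S T} → Merge m δ S T → ∀ a s → Valid m (a ∷⟨ s ⟩ S) →
                      ∀ {Q} → Q ∈ above (mergeFirst m s a T) → raise (boxDots δ) Q ∈ above (mergeFirst m s a S)

  above-Merge {δ} (here₁ {a} {c})         v Q∈ = ∈-above-raise a δ ⟨ c ⟩ Q∈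
  above-Merge {δ} (here₂ {a} {c} {s} {D}) v Q∈ = ∈-above-raise a δ (c ∷⟨ s ⟩ D) Q∈
  above-Merge     (there {a} {s} M)       v Q∈ = above-Merge-there M a s v Q∈

  above-Merge-there {δ} {S} {T} M a s v Q∈ with ∈-above-∷⁻ a s T Q∈
  ... | inj₁ (Q , Q∈T , refl) = ∈-above-prepend a s S (above-Merge M (valid-tail v) Q∈T)
  ... | inj₂ (Q , Q∈M , refl) = subst (_∈ above (a ∷⟨ s ⟩ S)) (raise-comm (boxDots s) (boxDots δ) Q)
                                      (∈-above-raise a s S (above-Merge-first M a s v Q∈M))

  above-Merge-first {δ} (here₁ {c} {d}) a s v (here refl) =
    ∈-above-raise (mergeVal m s a c) δ ⟨ d ⟩ (here (cong (λ t → (⟨ t ⟩ , 0)) (sym (mergeVal-assoc {D = ⟨ d ⟩} v))))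
  above-Merge-first {δ} (here₂ {c} {d} {s′} {D}) a s v Q∈ =
    ∈-above-raise (mergeVal m s a c) δ (d ∷⟨ s′ ⟩ D)
      (subst (λ t → _ ∈ above (t ∷⟨ s′ ⟩ D)) (sym (mergeVal-assoc {D = d ∷⟨ s′ ⟩ D} v)) Q∈)
  above-Merge-first (there {c} {s′} M) a s v Q∈ =
    above-Merge-there M (mergeVal m s a c) s′ (valid-mergeFirst v) Q∈

  above-complete : ∀ {D k P} → Valid m D → (D , k) ⪯[ m ] P → ∃[ Q ] Q ∈ above D × P ≡ raise k Q
  above-complete {D} {k} v ε = (D , 0) , self∈above D , cong (D ,_) (sym (ℕ.+-identityʳ k))
  above-complete v (plain M ◅ P⪯) with above-complete (valid-Merge M v) P⪯
  ... | Q , Q∈ , refl = raise 0 Q , above-Merge M v Q∈ , refl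
  above-complete {k = k} v (dotted M ◅ P⪯) with above-complete (valid-Merge M v) P⪯
  ... | (S , j) , Q∈ , refl = raise 1 (S , j) , above-Merge M v Q∈ , cong (S ,_) (sym (ℕ.+-suc k j))

  above-head : ∀ D → Valid m D → ∀ {Q} → Q ∈ above D → head D ≤ head (proj₁ Q)
  above-head = merge-ind HeadGrows base step
    where
    HeadGrows : BDC → Set
    HeadGrows D = Valid m D → ∀ {Q} → Q ∈ above D → head D ≤ head (proj₁ Q)
    base : ∀ a → HeadGrows ⟨ a ⟩
    base a v (here refl) = ℕ.≤-refl
    step : ∀ a δ B → HeadGrows B → HeadGrows (mergeFirst m δ a B) → HeadGrows (a ∷⟨ δ ⟩ B)
    step a δ B _ headM v Q∈ with ∈-above-∷⁻ a δ B Q∈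
    ... | inj₁ (Q , _ , refl)   = ℕ.≤-refl
    ... | inj₂ (Q , Q∈M , refl) = ℕ.≤-trans (ℕ.<⇒≤ (<mergeVal v))
                                    (subst (_≤ head (proj₁ Q)) (head-mergeFirst m δ a B) (headM (valid-mergeFirst v) Q∈M))

  above-unique : ∀ D → Valid m D → Unique (above D)
  above-unique = merge-ind UniqueAbove (λ _ _ → [] ∷ []) step
    where
    UniqueAbove : BDC → Set
    UniqueAbove D = Valid m D → Unique (above D)
    step : ∀ a δ B → UniqueAbove B → UniqueAbove (mergeFirst m δ a B) → UniqueAbove (a ∷⟨ δ ⟩ B)
    step a δ B uniqueB uniqueM v = subst Unique (sym (above-∷ a δ B))
      (Uniqueₚ.++⁺ (Uniqueₚ.map⁺ prepend-injective (uniqueB (valid-tail v)))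
                   (Uniqueₚ.map⁺ raise-injective (uniqueM (valid-mergeFirst v)))
                   disjoint)
      where
      prepend-injective : ∀ {P Q} → prepend a δ P ≡ prepend a δ Q → P ≡ Q
      prepend-injective {_ , _} {_ , _} refl = refl
      raise-injective : ∀ {P Q} → raise (boxDots δ) P ≡ raise (boxDots δ) Q → P ≡ Q
      raise-injective {_ , j} {_ , k} eq = cong₂ _,_ (cong proj₁ eq) (ℕ.+-cancelˡ-≡ (boxDots δ) j k (cong proj₂ eq))
      -- merging the first separator makes the first part strictly larger
      disjoint : ∀ {P} → ¬ (P ∈ map (prepend a δ) (above B) × P ∈ map (raise (boxDots δ)) (above (mergeFirst m δ a B)))
      disjoint (P∈ˡ , P∈ʳ) with ∈-map⁻ (prepend a δ) P∈ˡ | ∈-map⁻ (raise (boxDots δ)) P∈ʳ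
      ... | _ , _ , refl | Q , Q∈ , eq = ℕ.<-irrefl (cong (head ∘ proj₁) eq)
        (ℕ.<-≤-trans (<mergeVal v) (subst (_≤ head (proj₁ Q)) (head-mergeFirst m δ a B)
                                         (above-head _ (valid-mergeFirst v) Q∈)))

module SignedSum {n : ℕ} (x : Fin n → ℤ) (m : ℕ) where
  open Interval m

  hPart-λ : ∀ S → hPart n x λ[ S ] ≡ prodℤ (map (h n x) (α S))
  hPart-λ S = prodℤ-↭ (↭.map⁺ (h n x) (↭-trans (↭.↭-reverse (sort (α S))) (sort-↭ (α S))))

  term-prepend : ∀ a δ Q → term m n x (prepend a δ Q) ≡ - h n x a * term m n x Q
  term-prepend a δ (S , k) rewrite hPart-λ (a ∷⟨ δ ⟩ S) | hPart-λ S =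
    reorder (sign (ℓ S)) (h n x (m ∸ 1) ℤ.^ k) (h n x a) (prodℤ (map (h n x) (α S)))
    where
    reorder : ∀ σ p q r → ℤ.-1ℤ * σ * (p * (q * r)) ≡ - q * (σ * (p * r))
    reorder = solve-∀

  term-raise : ∀ j Q → term m n x (raise j Q) ≡ h n x (m ∸ 1) ℤ.^ j * term m n x Q
  term-raise j (S , k) rewrite ℤ.^-distribˡ-+-* (h n x (m ∸ 1)) j k =
    reorder (sign (ℓ S)) (h n x (m ∸ 1) ℤ.^ j) (h n x (m ∸ 1) ℤ.^ k) (hPart n x λ[ S ])
    where
    reorder : ∀ σ p q r → σ * (p * q * r) ≡ p * (σ * (q * r))
    reorder = solve-∀

  signedSum : BDC → ℤ
  signedSum D = ∑ (above D) (term m n x)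

  signedSum-∷ : ∀ a δ B →
    signedSum (a ∷⟨ δ ⟩ B) ≡ - h n x a * signedSum B + h n x (m ∸ 1) ℤ.^ boxDots δ * signedSum (mergeFirst m δ a B)
  signedSum-∷ a δ B = begin
    signedSum (a ∷⟨ δ ⟩ B)
      ≡⟨ cong (λ L → ∑ L (term m n x)) (above-∷ a δ B) ⟩
    ∑ (map (prepend a δ) (above B) ++ map (raise (boxDots δ)) (above (mergeFirst m δ a B))) (term m n x)
      ≡⟨ ∑-++ (map (prepend a δ) (above B)) _ (term m n x) ⟩
    ∑ (map (prepend a δ) (above B)) (term m n x) + ∑ (map (raise (boxDots δ)) (above (mergeFirst m δ a B))) (term m n x)
      ≡⟨ cong₂ _+_ (trans (∑-map (above B) (prepend a δ) (term m n x))
                          (trans (∑-cong (above B) (term-prepend a δ)) (∑-*ˡ (above B) (- h n x a) (term m n x))))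
                   (trans (∑-map (above M) (raise (boxDots δ)) (term m n x))
                          (trans (∑-cong (above M) (term-raise (boxDots δ)))
                                 (∑-*ˡ (above M) (h n x (m ∸ 1) ℤ.^ boxDots δ) (term m n x)))) ⟩
    - h n x a * signedSum B + h n x (m ∸ 1) ℤ.^ boxDots δ * signedSum (mergeFirst m δ a B) ∎
    where
    open ≡-Reasoning
    M = mergeFirst m δ a B

-- the overlaps o and o′ of each row of length b with the rows below and above
-- share at most one column: o + o′ ≤ b + 1
Spaced : ℕ → BDC → Set
Spaced m ⟨ _ ⟩        = ⊤
Spaced m (_ ∷⟨ δ ⟩ B) = ovl m δ ℕ.+ upperOverlap m B ≤ suc (head B) × Spaced m B

spaced-mergeFirst : ∀ {m} a δ B → Spaced m (a ∷⟨ δ ⟩ B) → Spaced m (mergeFirst m δ a B)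
spaced-mergeFirst a δ ⟨ c ⟩        _        = _
spaced-mergeFirst a δ (c ∷⟨ s ⟩ B) (_ , spB) = spB

upperOverlap≤head : ∀ {m B} → Valid m B → upperOverlap m B ≤ head B
upperOverlap≤head (one _)           = z≤n
upperOverlap≤head (cons 1≤b _)      = 1≤b
upperOverlap≤head (dot _ m≤b _ _) = m≤b

module _ (m : ℕ) where
  open Diagram m

  Block : ℕ → ℕ → BDC → Set
  Block r s D = ∃[ r′ ] ∃[ c ] All (_∈ placed r s D)
    ((r′ , c) ∷ (r′ , suc c) ∷ (suc r′ , c) ∷ (suc r′ , suc c) ∷ (suc (suc r′) , c) ∷ (suc (suc r′) , suc c) ∷ [])

  ∈-placed-bottom : ∀ r s D {c} → s ≤ c → c < s ℕ.+ head D → (r , c) ∈ placed r s D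
  ∈-placed-bottom r s D s≤c c<end =
    subst (_ ∈_) (sym (placed-split r s D)) (∈-++⁺ˡ (∈-rowCells r s (head D) s≤c c<end))

  ∈-placed-above : ∀ r s a δ B {q} → q ∈ placed (suc r) (s ℕ.+ a ∸ ovl m δ) B → q ∈ placed r s (a ∷⟨ δ ⟩ B)
  ∈-placed-above r s a δ B = ∈-++⁺ʳ (map (λ t → (r , s ℕ.+ t)) (upTo a))

  Block-above : ∀ r s a δ B → Block (suc r) (s ℕ.+ a ∸ ovl m δ) B → Block r s (a ∷⟨ δ ⟩ B)
  Block-above r s a δ B (r′ , c , cells∈) = r′ , c , All.map (∈-placed-above r s a δ B) cells∈

  ∈-placed-bottom² : ∀ r s D {c} → s ≤ c → suc (suc c) ≤ s ℕ.+ head D →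
    All (_∈ placed r s D) ((r , c) ∷ (r , suc c) ∷ [])
  ∈-placed-bottom² r s D s≤c 2+c≤end = ∈-placed-bottom r s D s≤c (ℕ.<-trans (ℕ.n<1+n _) 2+c≤end)
                                     ∷ ∈-placed-bottom r s D (ℕ.≤-trans s≤c (ℕ.n≤1+n _)) 2+c≤end ∷ []

-- a row of length b < 2m - 1 between two box-dots shares two columns with both neighbours
block-between-dots : ∀ {m} r s a b B → 2 ≤ m → m ≤ a → m ≤ b → m ≤ head B → suc b < m ℕ.+ m →
  Block m r s (a ∷⟨ true ⟩ (b ∷⟨ true ⟩ B))
block-between-dots {suc zero} r s a b B (s≤s ()) _ _ _ _
block-between-dots {m@(suc (suc m′))} r s a b B _ m≤a m≤b m≤c 1+b<2m
  with ℕ.m≤n⇒∃[o]m+o≡n m≤a | ℕ.m≤n⇒∃[o]m+o≡n m≤b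
... | a′ , refl | b′ , refl = r , t ℕ.+ m′ ,
    Allₚ.++⁺ bottom (Allₚ.++⁺ (All.map lift₁ middle) (All.map (lift₁ ∘ ∈-placed-above m (suc r) st₁ (m ℕ.+ b′) true B) top))
  where
  t = s ℕ.+ a′
  pair : ℕ → List (ℕ × ℕ)
  pair r′ = (r′ , t ℕ.+ m′) ∷ (r′ , suc (t ℕ.+ m′)) ∷ []
  D₁ = m ℕ.+ b′ ∷⟨ true ⟩ B
  st₁ = s ℕ.+ (m ℕ.+ a′) ∸ m
  st₂ = st₁ ℕ.+ (m ℕ.+ b′) ∸ m
  lift₁ = ∈-placed-above m r s (m ℕ.+ a′) true D₁
  after-dot : ∀ x y → x ℕ.+ (m ℕ.+ y) ∸ m ≡ x ℕ.+ y
  after-dot x y = trans (cong (_∸ m) (swap x m y)) (ℕ.m+n∸n≡m (x ℕ.+ y) m)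
    where
    swap : ∀ x m y → x ℕ.+ (m ℕ.+ y) ≡ x ℕ.+ y ℕ.+ m
    swap = ℕ-solve-∀
  t+m : suc (suc (t ℕ.+ m′)) ≡ t ℕ.+ m
  t+m = sym (trans (ℕ.+-suc t (suc m′)) (cong suc (ℕ.+-suc t m′)))
  b′≤m′ : b′ ≤ m′
  b′≤m′ = ℕ.≤-pred (ℕ.≤-pred (ℕ.+-cancelˡ-≤ m (suc (suc b′)) m
            (subst (_≤ m ℕ.+ m) (sym (trans (ℕ.+-suc m (suc b′)) (cong suc (ℕ.+-suc m b′)))) 1+b<2m)))
  bottom = ∈-placed-bottom² m r s (m ℕ.+ a′ ∷⟨ true ⟩ D₁) (ℕ.≤-trans (ℕ.m≤m+n s a′) (ℕ.m≤m+n t m′))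
             (ℕ.≤-reflexive (trans t+m (trans (ℕ.+-assoc s a′ m) (cong (s ℕ.+_) (ℕ.+-comm a′ m)))))
  st₂≡ : st₂ ≡ t ℕ.+ b′
  st₂≡ = trans (cong (λ st → st ℕ.+ (m ℕ.+ b′) ∸ m) (after-dot s a′)) (after-dot t b′)
  middle = subst (λ st → All (_∈ Diagram.placed m (suc r) st D₁) (pair (suc r))) (sym (after-dot s a′))
             (∈-placed-bottom² m (suc r) t D₁ (ℕ.m≤m+n t m′)
               (subst (_≤ t ℕ.+ (m ℕ.+ b′)) (sym t+m) (ℕ.+-monoʳ-≤ t (ℕ.m≤m+n m b′))))
  top = subst (λ st → All (_∈ Diagram.placed m (suc (suc r)) st B) (pair (suc (suc r)))) (sym st₂≡)
          (∈-placed-bottom² m (suc (suc r)) (t ℕ.+ b′) B (ℕ.+-monoʳ-≤ t b′≤m′)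
             (subst (_≤ t ℕ.+ b′ ℕ.+ head B) (sym t+m) (ℕ.+-mono-≤ (ℕ.m≤m+n t b′) m≤c)))

spaced : ∀ {m} D r s → 2 ≤ m → Valid m D → ¬ Block m r s D → Spaced m D
spaced ⟨ a ⟩        r s _   _ _       = _
spaced {m} (a ∷⟨ δ ⟩ B) r s 2≤m v noBlock =
  rowB δ B v noBlock , spaced B (suc r) (s ℕ.+ a ∸ ovl m δ) 2≤m (valid-tail v) (noBlock ∘ Block-above m r s a δ B)
  where
  rowB : ∀ δ B → Valid m (a ∷⟨ δ ⟩ B) → ¬ Block m r s (a ∷⟨ δ ⟩ B) →
         ovl m δ ℕ.+ upperOverlap m B ≤ suc (head B)
  rowB false B                v               _ = s≤s (upperOverlap≤head (valid-tail v))
  rowB true  ⟨ b ⟩            (dot _ _ m≤b _) _ = subst (_≤ suc b) (sym (ℕ.+-identityʳ m)) (ℕ.≤-trans m≤b (ℕ.n≤1+n b))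
  rowB true  (b ∷⟨ false ⟩ _) (dot _ _ m≤b _) _ = subst (_≤ suc b) (ℕ.+-comm 1 m) (s≤s m≤b)
  rowB true  (b ∷⟨ true ⟩ B′) (dot _ m≤a m≤b (dot _ _ m≤c _)) noBlock with m ℕ.+ m ℕ.≤? suc b
  ... | yes 2m≤1+b = 2m≤1+b
  ... | no  2m≰1+b = ⊥-elim (noBlock (block-between-dots r s a b B′ 2≤m m≤a m≤b m≤c (ℕ.≰⇒> 2m≰1+b)))

module Expansion {n : ℕ} (x : Fin n → ℤ) (m : ℕ) (1≤m : 1 ≤ m) where
  open RowFillings x m
  open SignedSum x m
  open Interval m

  H : ℤ
  H = h n x (m ∸ 1)

  s-mergeFirst : ∀ δ a B → s (mergeFirst m δ a B) ≡ Above.rowSum B (mergeVal m δ a (head B)) 0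
  s-mergeFirst δ a ⟨ c ⟩        = refl
  s-mergeFirst δ a (c ∷⟨ s ⟩ B) = refl

  ovl≡1+pred : ∀ δ → ovl m δ ≡ suc (ovl m δ ∸ 1)
  ovl≡1+pred false = refl
  ovl≡1+pred true  = trans (sym (ℕ.m∸n+n≡m 1≤m)) (ℕ.+-comm (m ∸ 1) 1)

  hFrom-overlap : ∀ δ → hFrom x (ovl m δ ∸ 1) 0 ≡ H ℤ.^ boxDots δ
  hFrom-overlap false = refl
  hFrom-overlap true  = trans (sym (h≡hFrom x (m ∸ 1))) (sym (ℤ.*-identityʳ H))

  s-recurrence : ∀ a δ B → Valid m (a ∷⟨ δ ⟩ B) → ovl m δ ℕ.+ upperOverlap m B ≤ suc (head B) →
    s (a ∷⟨ δ ⟩ B) ≡ h n x a * s B - H ℤ.^ boxDots δ * s (mergeFirst m δ a B)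
  s-recurrence a δ B v o+o′≤1+b =
    subst (λ a → s (a ∷⟨ δ ⟩ B) ≡ h n x a * s B - H ℤ.^ boxDots δ * s (mergeFirst m δ a B)) (sym a≡p+1+k) (begin
      s (a′ ∷⟨ δ ⟩ B)
        ≡⟨ add-sub (s (a′ ∷⟨ δ ⟩ B)) (hFrom x k 0 * R) ⟩
      s (a′ ∷⟨ δ ⟩ B) + hFrom x k 0 * R - hFrom x k 0 * R
        ≡⟨ cong (_- hFrom x k 0 * R) (sym (s-∷ p k δ B o≡1+k (subst (_≤ head B) o≡1+k o≤b) o′+k≤b)) ⟩
      hFrom x a′ 0 * s B - hFrom x k 0 * R
        ≡⟨ cong₂ (λ hₐ hₖ → hₐ * s B - hₖ * R) (sym (h≡hFrom x a′)) (hFrom-overlap δ) ⟩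
      h n x a′ * s B - H ℤ.^ boxDots δ * R
        ≡⟨ cong (λ t → h n x a′ * s B - H ℤ.^ boxDots δ * t)
                (sym (trans (s-mergeFirst δ a′ B) (cong (λ l → Above.rowSum B l 0) merged≡))) ⟩
      h n x a′ * s B - H ℤ.^ boxDots δ * s (mergeFirst m δ a′ B) ∎)
    where
    open ≡-Reasoning
    o = ovl m δ
    o≤a = proj₁ (valid-overlaps v)
    o≤b = proj₂ (valid-overlaps v)
    k = o ∸ 1
    p = a ∸ o
    a′ = p ℕ.+ suc k
    R = Above.rowSum B (p ℕ.+ suc (head B)) 0
    o≡1+k : o ≡ suc k
    o≡1+k = ovl≡1+pred δ
    a≡p+1+k : a ≡ a′
    a≡p+1+k = trans (sym (ℕ.m∸n+n≡m o≤a)) (cong (p ℕ.+_) o≡1+k)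
    o′+k≤b : upperOverlap m B ℕ.+ k ≤ head B
    o′+k≤b = subst (_≤ head B) (ℕ.+-comm k (upperOverlap m B))
               (ℕ.≤-pred (subst (λ o → o ℕ.+ upperOverlap m B ≤ suc (head B)) o≡1+k o+o′≤1+b))
    merged≡ : mergeVal m δ a′ (head B) ≡ p ℕ.+ suc (head B)
    merged≡ = ℕ.+-cancelʳ-≡ o _ _ (begin
      mergeVal m δ a′ (head B) ℕ.+ o   ≡⟨ mergeVal+ovl m δ (head B) (subst (_≤ a′) (sym o≡1+k) (ℕ.m≤n+m (suc k) p)) ⟩
      a′ ℕ.+ head B ℕ.+ 1              ≡⟨ cong (λ o → p ℕ.+ o ℕ.+ head B ℕ.+ 1) (sym o≡1+k) ⟩
      p ℕ.+ o ℕ.+ head B ℕ.+ 1         ≡⟨ shuffle p o (head B) ⟩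
      p ℕ.+ suc (head B) ℕ.+ o         ∎)
      where
      shuffle : ∀ p o b → p ℕ.+ o ℕ.+ b ℕ.+ 1 ≡ p ℕ.+ suc b ℕ.+ o
      shuffle = ℕ-solve-∀
    add-sub : ∀ y z → y ≡ y + z - z
    add-sub = solve-∀

  s≡signedSum : ∀ D → Valid m D → Spaced m D → s D ≡ sign (ℓ D) * signedSum D
  s≡signedSum = merge-ind Expands base step
    where
    Expands : BDC → Set
    Expands D = Valid m D → Spaced m D → s D ≡ sign (ℓ D) * signedSum D
    base : ∀ a → Expands ⟨ a ⟩
    base a _ _ = begin
      s ⟨ a ⟩                ≡⟨ Σw-cong a (λ u _ → cong [ incrFrom 0 u ]·_ (ℤ.*-identityʳ (monomial x u))) ⟩
      hFrom x a 0            ≡⟨ sym (h≡hFrom x a) ⟩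
      h n x a                ≡⟨ signs (h n x a) ⟩
      sign 1 * (sign 1 * (1ℤ * (h n x a * 1ℤ)) + 0ℤ)
                             ≡⟨ cong (λ t → sign 1 * (sign 1 * (1ℤ * t) + 0ℤ)) (sym (hPart-λ ⟨ a ⟩)) ⟩
      sign 1 * signedSum ⟨ a ⟩ ∎
      where
      open ≡-Reasoning
      signs : ∀ y → y ≡ sign 1 * (sign 1 * (1ℤ * (y * 1ℤ)) + 0ℤ)
      signs = solve-∀
    step : ∀ a δ B → Expands B → Expands (mergeFirst m δ a B) → Expands (a ∷⟨ δ ⟩ B)
    step a δ B sB sM v sp@(o+o′≤1+b , spB) = begin
      s (a ∷⟨ δ ⟩ B)
        ≡⟨ s-recurrence a δ B v o+o′≤1+b ⟩
      h n x a * s B - H ℤ.^ boxDots δ * s M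
        ≡⟨ cong₂ (λ t u → h n x a * t - H ℤ.^ boxDots δ * u) (sB (valid-tail v) spB)
                 (trans (sM (valid-mergeFirst v) (spaced-mergeFirst a δ B sp))
                        (cong (λ l → sign l * signedSum M) (ℓ-mergeFirst δ B))) ⟩
      h n x a * (sign (ℓ B) * signedSum B) - H ℤ.^ boxDots δ * (sign (ℓ B) * signedSum M)
        ≡⟨ signs (h n x a) (H ℤ.^ boxDots δ) (sign (ℓ B)) (signedSum B) (signedSum M) ⟩
      sign (suc (ℓ B)) * (- h n x a * signedSum B + H ℤ.^ boxDots δ * signedSum M)
        ≡⟨ cong (sign (suc (ℓ B)) *_) (sym (signedSum-∷ a δ B)) ⟩
      sign (suc (ℓ B)) * signedSum (a ∷⟨ δ ⟩ B) ∎
      where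
      open ≡-Reasoning
      M = mergeFirst m δ a B
      ℓ-mergeFirst : ∀ δ B → ℓ (mergeFirst m δ a B) ≡ ℓ B
      ℓ-mergeFirst δ ⟨ _ ⟩        = refl
      ℓ-mergeFirst δ (_ ∷⟨ _ ⟩ _) = refl
      signs : ∀ ha hk σ ΣB ΣM → ha * (σ * ΣB) - hk * (σ * ΣM) ≡ ℤ.-1ℤ * σ * (- ha * ΣB + hk * ΣM)
      signs = solve-∀

∈-above⇔⪯ : ∀ {m D} → Valid m D → ∀ {P} → P ∈ Interval.above m D ⇔ (D , 0) ⪯[ m ] P
∈-above⇔⪯ {m} {D} v = mk⇔ (above-sound D) λ D⪯P →
  let (Q , Q∈ , P≡Q) = above-complete v D⪯P in subst (_∈ above D) (sym P≡Q) Q∈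
  where open Interval m

proposition2p3 : (m : ℕ) → 2 ≤ m → (D : BDC) → ThickenedRibbon m D →
    (L : List Pair) → Unique L → ((P : Pair) → (P ∈ L) ⇔ ((D , 0) ⪯[ m ] P)) →
    (n : ℕ) (x : Fin n → ℤ) →
    skewSchur m n x D ≡ sign (ℓ D) * sumℤ (map (term m n x) L)
proposition2p3 m 2≤m D (valid , _ , no3×2) L unique-L L≈ n x = begin
  skewSchur m n x D             ≡⟨ Diagram.skewSchur≡s m x D (Valid⇒OverlapsFit valid) ⟩
  s D                           ≡⟨ s≡signedSum D valid (spaced D 0 0 2≤m valid no3×2) ⟩
  sign (ℓ D) * signedSum D      ≡⟨ cong (sign (ℓ D) *_) (∑-unique (term m n x) (Interval.above-unique m D valid) unique-L
                                     (⇔.trans (∈-above⇔⪯ valid) (⇔.sym (L≈ _)))) ⟩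
  sign (ℓ D) * ∑ L (term m n x) ∎
  where
  open ≡-Reasoning
  open Expansion x m (ℕ.≤-trans (s≤s z≤n) 2≤m)
  open RowFillings x m using (s)
  open SignedSum x m using (signedSum)
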